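{- Let $\mathcal{G}=(V,E)$ be a graph with chromatic number $3$, and let $V=V_1\cup V_2\cup V_3$ be a partition into color classes of a proper $3$-coloring. For $i\in\{1,2,3\}$ let $2\rho_i-1$ be the odd girth of the contracted graph $\mathcal{G}/V_i$. Then the integrality gap of the standard vertex cover linear programming relaxation satisfies \[IG(\mathcal{G})\le 1+\min_{i\in\{1,2,3\}}\frac{1}{2\rho_i-1}.\] Moreover, equality holds if one color class contains only one vertex.
   Context: The standard relaxation $P(\mathcal{G})$ with weights $w:V\to\mathbb{R}_+$ is $\min\sum_v w_vx_v$ s.t. $x_u+x_v\ge1$ for all $(u,v)\in E$, $x\ge0$. The integrality gap $IG(\mathcal{G})$ is the supremum, over weight functions $w:V\to\mathbb{R}_+$ (with positive LP value), of the ratio between the minimum weight of a vertex cover and the optimal value of $P(\mathcal{G})$. $\mathcal{G}/V_i$ is the multigraph obtained by contracting all vertices of $V_i$ into a single new vertex (parallel edges kept, no self-loops). The odd girth is the length of a shortest odd cycle.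
   Formalization: The weight functions w take nonnegative rational values instead of values in $\mathbb{R}_+$, and the feasible points of $P(\mathcal{G})$ have rational coordinates. -}

module Defs where

open import Data.Nat using (ℕ; zero; suc; _≥_)
import Data.Nat as ℕ
open import Data.Fin using (Fin; zero; suc; toℕ; inject₁; fromℕ)
open import Data.Fin.Properties using ()
open import Data.Maybe using (Maybe; just; nothing)
open import Data.Bool using (Bool; true; false; if_then_else_)
open import Data.Integer using (+_)
open import Data.Rational using (ℚ; 0ℚ; 1ℚ; _+_; _*_; _-_; _≤_; _<_; _/_; _⊓_)
open import Data.Product using (Σ; ∃; ∃-syntax; _×_; _,_)
open import Data.Sum using (_⊎_)
open import Relation.Binary.PropositionalEquality using (_≡_; _≢_)
open import Relation.Nullary using (¬_; yes; no)
open import Function.Definitions using (Injective)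
open import Data.Fin using (_≟_)

record Graph (n : ℕ) : Set₁ where
  field
    Adj   : Fin n → Fin n → Set
    sym   : ∀ {u v} → Adj u v → Adj v u
    irrefl : ∀ {u} → ¬ Adj u u
open Graph public

ProperColoring : ∀ {n} → Graph n → (k : ℕ) → (Fin n → Fin k) → Set
ProperColoring G k c = ∀ u v → Adj G u v → c u ≢ c v

ChromaticNumber3 : ∀ {n} → Graph n → Set
ChromaticNumber3 G =
  (∃[ c ] ProperColoring G 3 c) × (¬ (∃[ c ] ProperColoring G 2 c))

-- A cycle of length k = suc m in an adjacency relation A on vertex type V:
-- pairwise distinct vertices w 0, …, w m with w j ~ w (j+1) and w m ~ w 0,
-- and k ≥ 3 (for k ≥ 3 the traversed edges are automatically distinct).
record Cycle {V : Set} (A : V → V → Set) (k : ℕ) : Set where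
  field
    m        : ℕ
    len      : k ≡ suc m
    long     : k ≥ 3
    w        : Fin (suc m) → V
    distinct : Injective _≡_ _≡_ w
    step     : ∀ (j : Fin m) → A (w (inject₁ j)) (w (suc j))
    close    : A (w (fromℕ m)) (w zero)

Odd : ℕ → Set
Odd k = ∃[ r ] k ≡ suc (2 ℕ.* r)

IsOddGirth : {V : Set} → (V → V → Set) → ℕ → Set
IsOddGirth A g =
  Odd g × Cycle A g × (∀ k → Odd k → Cycle A k → g ℕ.≤ k)

-- Vertices of G/V_i are represented in Maybe (Fin n): `nothing` is the new
-- vertex obtained by contracting V_i, and `just v` (c v ≢ i) is an
-- uncontracted vertex.  Every edge u v of G becomes an edge π u – π v
-- (parallel edges are irrelevant for cycles of length ≥ 3; no loops arise
-- since V_i is independent).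

contractMap : ∀ {n k} → (Fin n → Fin k) → Fin k → Fin n → Maybe (Fin n)
contractMap c i v with c v ≟ i
... | yes _ = nothing
... | no  _ = just v

ContractAdj : ∀ {n k} → Graph n → (Fin n → Fin k) → Fin k →
              Maybe (Fin n) → Maybe (Fin n) → Set
ContractAdj G c i x y =
  ∃[ u ] ∃[ v ] (Adj G u v × contractMap c i u ≡ x × contractMap c i v ≡ y)

sumFin : ∀ {n} → (Fin n → ℚ) → ℚ
sumFin {zero}  f = 0ℚ
sumFin {suc n} f = f zero + sumFin (λ j → f (suc j))

NonNeg : ∀ {n} → (Fin n → ℚ) → Set
NonNeg x = ∀ v → 0ℚ ≤ x v

FracCover : ∀ {n} → Graph n → (Fin n → ℚ) → Set
FracCover G x = NonNeg x × (∀ u v → Adj G u v → 1ℚ ≤ x u + x v)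

objective : ∀ {n} → (Fin n → ℚ) → (Fin n → ℚ) → ℚ
objective w x = sumFin (λ v → w v * x v)

IsLPOpt : ∀ {n} → Graph n → (Fin n → ℚ) → ℚ → Set
IsLPOpt G w z =
  (∃[ x ] (FracCover G x × objective w x ≡ z)) ×
  (∀ x → FracCover G x → z ≤ objective w x)

VertexCover : ∀ {n} → Graph n → (Fin n → Bool) → Set
VertexCover G C = ∀ u v → Adj G u v → (C u ≡ true) ⊎ (C v ≡ true)

coverWeight : ∀ {n} → (Fin n → ℚ) → (Fin n → Bool) → ℚ
coverWeight w C = sumFin (λ v → if C v then w v else 0ℚ)

IsVCOpt : ∀ {n} → Graph n → (Fin n → ℚ) → ℚ → Set
IsVCOpt G w m =
  (∃[ C ] (VertexCover G C × coverWeight w C ≡ m)) ×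
  (∀ C → VertexCover G C → m ≤ coverWeight w C)

IGAtMost : ∀ {n} → Graph n → ℚ → Set
IGAtMost G B =
  ∀ (w : Fin _ → ℚ) (z m : ℚ) → NonNeg w → IsLPOpt G w z → 0ℚ < z →
  IsVCOpt G w m → m ≤ B * z

IsIntegralityGap : ∀ {n} → Graph n → ℚ → Set
IsIntegralityGap G B =
  IGAtMost G B ×
  (∀ (ε : ℚ) → 0ℚ < ε →
     ∃[ w ] ∃[ z ] ∃[ m ] (NonNeg w × IsLPOpt G w z × 0ℚ < z ×
                           IsVCOpt G w m × (B - ε) * z < m))

-- 1/(2ρ-1) for ρ ≥ 1 (value at ρ = 0 is irrelevant: odd girth ≥ 3 forces ρ ≥ 2)
oddRecip : ℕ → ℚ
oddRecip zero    = 0ℚ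
oddRecip (suc r) = + 1 / suc (2 ℕ.* r)

gapBound : (Fin 3 → ℕ) → ℚ
gapBound ρ = 1ℚ + (oddRecip (ρ zero) ⊓ (oddRecip (ρ (suc zero)) ⊓ oddRecip (ρ (suc (suc zero)))))

{-# OPTIONS --safe #-}
-- Take the colour i attaining the minimum and write 2ρᵢ − 1 = g = 2K + 1. An odd walk
-- between two vertices of Vᵢ closes up in G/Vᵢ, so it has length at least g. Hence the distance
-- from Vᵢ, capped at K and signed by the 2-colouring of G − Vᵢ with the two other colours, maps G
-- homomorphically to the cycle C_g; the g rotations of the odd residues of C_g pull back to
-- independent sets Iₜ, and every vertex lies outside exactly K + 1 of them. Write an optimal
-- fractional cover as x = X / D. For every threshold j < D and rotation t the set
-- {v : xᵥ ≥ 1 − j/2D} ∪ {v ∉ Iₜ : xᵥ > j/2D} is a vertex cover, and v lies in at most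
-- 2(K + 1)·D·xᵥ of these D·g covers, so the cheapest one costs at most (1 + 1/g) times the LP value.
--
-- If Vᵢ = {v₀} then G/Vᵢ is a copy of G, so G has a shortest odd cycle of length g, and
-- no two of its odd-indexed vertices are adjacent (such a chord would close a shorter odd cycle).
-- With weight 1 on the cycle the LP optimum is g/2 (all halves) while the cover optimum is K + 1
-- (all but the K odd-indexed cycle vertices), a ratio of exactly 1 + 1/g.
module Submission where

module Arithmetic where

  open import Data.Nat using (ℕ; zero; suc; _+_; _*_; _∸_; _⊓_; _%_; _<_; _≤_; _<?_; _≤?_; z≤n; s≤s; s≤s⁻¹; NonZero; parity)
  open import Data.Nat.DivMod using (m<n⇒m%n≡m; [m+n]%n≡m%n)
  open import Data.Nat.Properties
    using ( ≤-refl; ≤-reflexive; ≤-trans; ≤-total; <⇒≤; ≮⇒≥; ≰⇒>; m<n⇒m<1+n; m≤n⇒m≤1+n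
          ; +-comm; +-assoc; +-suc; +-identityʳ; +-cancelʳ-≡; +-mono-≤; +-monoʳ-≤; +-commutativeSemigroup
          ; *-zeroʳ; *-identityʳ; *-distribˡ-+
          ; m≤n⇒m⊓n≡m; m≥n⇒m⊓n≡n; 0∸n≡0; +-∸-assoc; m≤n⇒m∸n≡0; m+n≤o⇒m≤o∸n; m≤n+o⇒m∸n≤o; m≤n+m∸n
          ; m+[n∸m]≡n; [m+n]∸[m+o]≡n∸o; module ≤-Reasoning)
  open import Data.Parity.Base as ℙ using (0ℙ; 1ℙ; _⁻¹)
  open import Data.Parity.Properties using (_≟_; +-homo-+; *-homo-*; p+p≡0ℙ)
  open import Data.Bool using (Bool; true; false; not)
  open import Data.Product using (_,_)
  open import Data.Sum using (_⊎_; inj₁; inj₂; [_,_]′)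
  open import Algebra.Properties.CommutativeSemigroup +-commutativeSemigroup using (interchange)
  open import Function using (_∘_)
  open import Relation.Unary using (Decidable)
  open import Relation.Nullary using (does; yes; no; contradiction)
  open import Relation.Nullary.Decidable using (dec-true; dec-false)
  open import Relation.Binary.PropositionalEquality using (_≡_; refl; cong; cong₂; sym; trans; module ≡-Reasoning)

  open import Defs using (Odd)

  Odd⇒parity≡1ℙ : ∀ {k} → Odd k → parity k ≡ 1ℙ
  Odd⇒parity≡1ℙ (r , refl) = trans (+-homo-+ 1 (2 * r)) (cong _⁻¹ (*-homo-* 2 r))

  parity≡1ℙ⇒Odd : ∀ k → parity k ≡ 1ℙ → Odd k
  parity≡1ℙ⇒Odd zero          ()
  parity≡1ℙ⇒Odd (suc zero)    _ = 0 , refl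
  parity≡1ℙ⇒Odd (suc (suc k)) p with parity≡1ℙ⇒Odd k p
  ... | r , refl = suc r , cong (λ m → suc (suc m)) (sym (+-suc r (r + 0)))

  Odd-+ : ∀ a b → Odd (a + b) → Odd a ⊎ Odd b
  Odd-+ a b odd with parity a in pa
  ... | 1ℙ = inj₁ (parity≡1ℙ⇒Odd a pa)
  ... | 0ℙ = inj₂ (parity≡1ℙ⇒Odd b (begin
    parity b               ≡⟨ cong (ℙ._+ parity b) pa ⟨
    parity a ℙ.+ parity b  ≡⟨ +-homo-+ a b ⟨
    parity (a + b)         ≡⟨ Odd⇒parity≡1ℙ odd ⟩
    1ℙ                     ∎))
    where open ≡-Reasoning

  isOdd : ℕ → Bool
  isOdd n = does (parity n ≟ 1ℙ)

  isOdd⇒parity≡1ℙ : ∀ {n} → isOdd n ≡ true → parity n ≡ 1ℙ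
  isOdd⇒parity≡1ℙ {n} odd with parity n ≟ 1ℙ | odd
  ... | yes p | _ = p

  sumBelow : ℕ → (ℕ → ℕ) → ℕ
  sumBelow zero    h = 0
  sumBelow (suc k) h = sumBelow k h + h k

  ⟦_⟧ : Bool → ℕ
  ⟦ true ⟧  = 1
  ⟦ false ⟧ = 0

  ⟦b⟧+⟦not-b⟧ : ∀ b → ⟦ b ⟧ + ⟦ not b ⟧ ≡ 1
  ⟦b⟧+⟦not-b⟧ true  = refl
  ⟦b⟧+⟦not-b⟧ false = refl

  sumBelow-cong : ∀ k {h h′ : ℕ → ℕ} → (∀ t → t < k → h t ≡ h′ t) → sumBelow k h ≡ sumBelow k h′
  sumBelow-cong zero    eq = refl
  sumBelow-cong (suc k) eq = cong₂ _+_ (sumBelow-cong k (λ t t<k → eq t (m<n⇒m<1+n t<k))) (eq k ≤-refl)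

  sumBelow-mono : ∀ k {h h′ : ℕ → ℕ} → (∀ t → t < k → h t ≤ h′ t) → sumBelow k h ≤ sumBelow k h′
  sumBelow-mono zero    le = z≤n
  sumBelow-mono (suc k) le = +-mono-≤ (sumBelow-mono k (λ t t<k → le t (m<n⇒m<1+n t<k))) (le k ≤-refl)

  sumBelow-+ : ∀ k (h h′ : ℕ → ℕ) → sumBelow k (λ t → h t + h′ t) ≡ sumBelow k h + sumBelow k h′
  sumBelow-+ zero    h h′ = refl
  sumBelow-+ (suc k) h h′ = begin
    sumBelow k (λ t → h t + h′ t) + (h k + h′ k)      ≡⟨ cong (_+ (h k + h′ k)) (sumBelow-+ k h h′) ⟩
    (sumBelow k h + sumBelow k h′) + (h k + h′ k)     ≡⟨ interchange (sumBelow k h) (sumBelow k h′) (h k) (h′ k) ⟩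
    (sumBelow k h + h k) + (sumBelow k h′ + h′ k)     ∎
    where open ≡-Reasoning

  sumBelow-*ˡ : ∀ k c (h : ℕ → ℕ) → sumBelow k (λ t → c * h t) ≡ c * sumBelow k h
  sumBelow-*ˡ zero    c h = sym (*-zeroʳ c)
  sumBelow-*ˡ (suc k) c h = trans (cong (_+ c * h k) (sumBelow-*ˡ k c h)) (sym (*-distribˡ-+ c (sumBelow k h) (h k)))

  sumBelow-const : ∀ k c → sumBelow k (λ _ → c) ≡ k * c
  sumBelow-const zero    c = refl
  sumBelow-const (suc k) c = trans (cong (_+ c) (sumBelow-const k c)) (+-comm (k * c) c)

  sumBelow-suc : ∀ k (h : ℕ → ℕ) → sumBelow (suc k) h ≡ h 0 + sumBelow k (h ∘ suc)
  sumBelow-suc zero    h = +-comm 0 (h 0)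
  sumBelow-suc (suc k) h = trans (cong (_+ h (suc k)) (sumBelow-suc k h)) (+-assoc (h 0) _ _)

  count-complement : ∀ k (b : ℕ → Bool) → sumBelow k (λ t → ⟦ b t ⟧) + sumBelow k (λ t → ⟦ not (b t) ⟧) ≡ k
  count-complement k b = begin
    sumBelow k (λ t → ⟦ b t ⟧) + sumBelow k (λ t → ⟦ not (b t) ⟧) ≡⟨ sumBelow-+ k _ _ ⟨
    sumBelow k (λ t → ⟦ b t ⟧ + ⟦ not (b t) ⟧)                     ≡⟨ sumBelow-cong k (λ t _ → ⟦b⟧+⟦not-b⟧ (b t)) ⟩
    sumBelow k (λ _ → 1)                                           ≡⟨ sumBelow-const k 1 ⟩
    k * 1                                                          ≡⟨ *-identityʳ k ⟩
    k                                                              ∎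
    where open ≡-Reasoning

  count-< : ∀ k a → sumBelow k (λ j → ⟦ does (j <? a) ⟧) ≡ k ⊓ a
  count-< zero    a = refl
  count-< (suc k) a with k <? a
  ... | yes k<a = trans (cong₂ _+_ (trans (count-< k a) (m≤n⇒m⊓n≡m (<⇒≤ k<a))) (cong ⟦_⟧ (dec-true (k <? a) k<a)))
                        (trans (+-comm k 1) (sym (m≤n⇒m⊓n≡m k<a)))
  ... | no  k≮a = trans (cong₂ _+_ (trans (count-< k a) (m≥n⇒m⊓n≡n (≮⇒≥ k≮a))) (cong ⟦_⟧ (dec-false (k <? a) k≮a)))
                        (trans (+-identityʳ a) (sym (m≥n⇒m⊓n≡n (m≤n⇒m≤1+n (≮⇒≥ k≮a)))))

  count-≥ : ∀ k e → sumBelow k (λ j → ⟦ does (e ≤? j) ⟧) ≡ k ∸ e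
  count-≥ zero    e = sym (0∸n≡0 e)
  count-≥ (suc k) e with e ≤? k
  ... | yes e≤k = trans (cong₂ _+_ (count-≥ k e) (cong ⟦_⟧ (dec-true (e ≤? k) e≤k)))
                        (trans (+-comm (k ∸ e) 1) (sym (+-∸-assoc 1 e≤k)))
  ... | no  e≰k = trans (cong₂ _+_ (trans (count-≥ k e) (m≤n⇒m∸n≡0 (<⇒≤ (≰⇒> e≰k)))) (cong ⟦_⟧ (dec-false (e ≤? k) e≰k)))
                        (sym (m≤n⇒m∸n≡0 (≰⇒> e≰k)))

  count-odd : ∀ m → sumBelow (m + m) (λ t → ⟦ isOdd t ⟧) ≡ m
  count-odd zero    = refl
  count-odd (suc m) = begin
    sumBelow (suc m + suc m) P                                   ≡⟨ cong (λ k → sumBelow (suc k) P) (+-suc m m) ⟩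
    sumBelow (m + m) P + ⟦ isOdd (m + m) ⟧ + ⟦ isOdd (suc (m + m)) ⟧
                                                                 ≡⟨ cong₂ _+_ (cong₂ _+_ (count-odd m) (cong ⟦_⟧ℙ even))
                                                                              (cong ⟦_⟧ℙ (trans (+-homo-+ 1 (m + m)) (cong _⁻¹ even))) ⟩
    m + 0 + 1                                                    ≡⟨ cong (_+ 1) (+-identityʳ m) ⟩
    m + 1                                                        ≡⟨ +-comm m 1 ⟩
    suc m                                                        ∎
    where
    open ≡-Reasoning
    P = λ t → ⟦ isOdd t ⟧
    ⟦_⟧ℙ = λ p → ⟦ does (p ≟ 1ℙ) ⟧
    even : parity (m + m) ≡ 0ℙ
    even = trans (+-homo-+ m m) (p+p≡0ℙ (parity m))

  sumBelow-rotate : ∀ g .{{_ : NonZero g}} (h : ℕ → ℕ) p →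
                    sumBelow g (λ t → h ((p + t) % g)) ≡ sumBelow g h
  sumBelow-rotate g h zero    = sumBelow-cong g (λ t t<g → cong h (m<n⇒m%n≡m t<g))
  sumBelow-rotate g h (suc p) = trans (+-cancelʳ-≡ (F 0) _ _ shift) (sumBelow-rotate g h p)
    where
    F = λ t → h ((p + t) % g)
    shift : sumBelow g (λ t → h ((suc p + t) % g)) + F 0 ≡ sumBelow g F + F 0
    shift = begin
      sumBelow g (λ t → h ((suc p + t) % g)) + F 0 ≡⟨ cong (_+ F 0) (sumBelow-cong g (λ t _ → cong (λ m → h (m % g)) (sym (+-suc p t)))) ⟩
      sumBelow g (F ∘ suc) + F 0                   ≡⟨ +-comm _ (F 0) ⟩
      F 0 + sumBelow g (F ∘ suc)                   ≡⟨ sumBelow-suc g F ⟨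
      sumBelow g F + F g                           ≡⟨ cong (λ m → sumBelow g F + h m) ([m+n]%n≡m%n p g) ⟩
      sumBelow g F + h (p % g)                     ≡⟨ cong (λ m → sumBelow g F + h (m % g)) (+-identityʳ p) ⟨
      sumBelow g F + F 0                           ∎
      where open ≡-Reasoning

  threshold-count : ∀ D a → sumBelow D (λ j → ⟦ does (j <? a) ⟧) + sumBelow D (λ j → ⟦ does ((D + D) ∸ a ≤? j) ⟧) ≤ a
  threshold-count D a = begin
    sumBelow D (λ j → ⟦ does (j <? a) ⟧) + sumBelow D (λ j → ⟦ does ((D + D) ∸ a ≤? j) ⟧)
                                         ≡⟨ cong₂ _+_ (count-< D a) (count-≥ D ((D + D) ∸ a)) ⟩
    D ⊓ a + (D ∸ ((D + D) ∸ a))          ≤⟨ [ small , large ]′ (≤-total a D) ⟩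
    a                                    ∎
    where
    open ≤-Reasoning
    small : a ≤ D → D ⊓ a + (D ∸ ((D + D) ∸ a)) ≤ a
    small a≤D = ≤-reflexive (begin-equality
      D ⊓ a + (D ∸ ((D + D) ∸ a)) ≡⟨ cong₂ _+_ (m≥n⇒m⊓n≡n a≤D) (m≤n⇒m∸n≡0 (m+n≤o⇒m≤o∸n D (+-monoʳ-≤ D a≤D))) ⟩
      a + 0                       ≡⟨ +-identityʳ a ⟩
      a                           ∎)
    large : D ≤ a → D ⊓ a + (D ∸ ((D + D) ∸ a)) ≤ a
    large D≤a = begin
      D ⊓ a + (D ∸ ((D + D) ∸ a))   ≡⟨ cong₂ (λ x y → x + (D ∸ ((D + D) ∸ y))) (m≤n⇒m⊓n≡m D≤a) (sym D+b≡a) ⟩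
      D + (D ∸ ((D + D) ∸ (D + b))) ≡⟨ cong (λ x → D + (D ∸ x)) ([m+n]∸[m+o]≡n∸o D D b) ⟩
      D + (D ∸ (D ∸ b))             ≤⟨ +-monoʳ-≤ D (m≤n+o⇒m∸n≤o D (D ∸ b) (≤-trans (m≤n+m∸n D b)
                                                                              (≤-reflexive (+-comm b (D ∸ b))))) ⟩
      D + b                         ≡⟨ D+b≡a ⟩
      a                             ∎
      where
      b = a ∸ D
      D+b≡a : D + b ≡ a
      D+b≡a = m+[n∸m]≡n D≤a

  least : {P : ℕ → Set} → Decidable P → ℕ → ℕ
  least P? zero = zero
  least P? (suc b) with P? 0
  ... | yes _ = 0
  ... | no  _ = suc (least (λ n → P? (suc n)) b)

  least-≤ : ∀ {P : ℕ → Set} (P? : Decidable P) → ∀ b → least P? b ≤ b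
  least-≤ P? zero = z≤n
  least-≤ P? (suc b) with P? 0
  ... | yes _ = z≤n
  ... | no  _ = s≤s (least-≤ (λ n → P? (suc n)) b)

  least-minimal : ∀ {P : ℕ → Set} (P? : Decidable P) → ∀ b {d} → P d → least P? b ≤ d
  least-minimal P? zero    _ = z≤n
  least-minimal P? (suc b) {d} Pd with P? 0
  least-minimal P? (suc b) {d}     Pd | yes _  = z≤n
  least-minimal P? (suc b) {zero}  Pd | no ¬P0 = contradiction Pd ¬P0
  least-minimal P? (suc b) {suc d} Pd | no _   = s≤s (least-minimal (λ n → P? (suc n)) b Pd)

  least-satisfies : ∀ {P : ℕ → Set} (P? : Decidable P) → ∀ b → least P? b < b → P (least P? b)
  least-satisfies P? (suc b) lt with P? 0
  ... | yes P0 = P0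
  ... | no  _  = least-satisfies (λ n → P? (suc n)) b (s≤s⁻¹ lt)

module Rationals where

  open import Data.Nat as ℕ using (ℕ; zero; suc; z≤n; s≤s)
  open import Data.Nat.Coprimality using (1-coprimeTo) renaming (sym to coprime-sym)
  import Data.Nat.Properties as ℕ
  open import Data.Fin using (Fin; zero; suc; toℕ) renaming (_≟_ to _≟ᶠ_)
  open import Data.Bool using (true; false; if_then_else_)
  import Data.Integer as ℤ
  import Data.Integer.Properties as ℤ
  open import Data.Rational using (ℚ; mkℚ; 0ℚ; 1ℚ; _+_; _*_; _/_; _≤_; _<_; nonNegative)
  open import Data.Rational.Properties
    using ( ≤-refl; <-≤-trans; <-irrefl; <-respˡ-≡; nonNegative⁻¹; positive⁻¹; negative⁻¹
          ; +-comm; +-identityˡ; +-identityʳ; +-mono-≤; +-monoʳ-≤; +-mono-<-≤; +-monoˡ-<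
          ; *-identityˡ; *-identityʳ; *-zeroˡ; *-zeroʳ; *-inverseʳ; *-monoˡ-≤-nonNeg
          ; /-cong; ↥p/↧p≡p; +-*-commutativeRing; module ≤-Reasoning)
  open import Data.Rational.Solver using (module +-*-Solver)
  open import Data.Product using (Σ-syntax; ∃-syntax; _,_)
  open import Algebra.Bundles using (CommutativeRing)
  open import Relation.Nullary using (does; yes; no; contradiction)
  open import Relation.Binary.PropositionalEquality using (_≡_; refl; cong; cong₂; sym; trans; subst; module ≡-Reasoning)

  open import Algebra.Properties.Semiring.Mult (CommutativeRing.semiring +-*-commutativeRing)
    using (×-homo-+; ×1-homo-*; ×-assoc-*) renaming (_×_ to _×ℚ_)
  open import Algebra.Properties.Semiring.Sum (CommutativeRing.semiring +-*-commutativeRing)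
    using ( sum; sum-cong-≗; ∑-comm; ∑-distrib-+; *-distribˡ-sum; *-distribʳ-sum
          ; sum-init-last; sum-replicate; sum-replicate-zero) public
  import Algebra.Properties.Semiring.Sum ℕ.+-*-semiring as ℕΣ

  open import Defs using (sumFin; NonNeg)
  open Arithmetic using (sumBelow; sumBelow-suc; ⟦_⟧)

  toℚ : ℕ → ℚ
  toℚ n = n ×ℚ 1ℚ

  toℚ-+ : ∀ m n → toℚ (m ℕ.+ n) ≡ toℚ m + toℚ n
  toℚ-+ m n = ×-homo-+ 1ℚ m n

  toℚ-* : ∀ m n → toℚ (m ℕ.* n) ≡ toℚ m * toℚ n
  toℚ-* = ×1-homo-*

  toℚ-nonNeg : ∀ n → 0ℚ ≤ toℚ n
  toℚ-nonNeg zero    = ≤-refl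
  toℚ-nonNeg (suc n) = +-mono-≤ (nonNegative⁻¹ 1ℚ) (toℚ-nonNeg n)

  toℚ-pos : ∀ n → 0ℚ < toℚ (suc n)
  toℚ-pos n = +-mono-<-≤ (positive⁻¹ 1ℚ) (toℚ-nonNeg n)

  toℚ-mono-≤ : ∀ {m n} → m ℕ.≤ n → toℚ m ≤ toℚ n
  toℚ-mono-≤ {n = n} z≤n = toℚ-nonNeg n
  toℚ-mono-≤ (s≤s m≤n)   = +-monoʳ-≤ 1ℚ (toℚ-mono-≤ m≤n)

  toℚ-mono-< : ∀ {m n} → m ℕ.< n → toℚ m < toℚ n
  toℚ-mono-< {m} m<n =
    <-≤-trans (<-respˡ-≡ (+-identityˡ (toℚ m)) (+-monoˡ-< (toℚ m) (positive⁻¹ 1ℚ))) (toℚ-mono-≤ m<n)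

  toℚ-cancel-≤ : ∀ {m n} → toℚ m ≤ toℚ n → m ℕ.≤ n
  toℚ-cancel-≤ {m} {n} le with m ℕ.≤? n
  ... | yes m≤n = m≤n
  ... | no  m≰n = contradiction (<-≤-trans (toℚ-mono-< (ℕ.≰⇒> m≰n)) le) (<-irrefl refl)

  toℚ≡mkℚ : ∀ k → toℚ k ≡ mkℚ (ℤ.+ k) 0 (coprime-sym (1-coprimeTo k))
  toℚ≡mkℚ zero    = refl
  toℚ≡mkℚ (suc k) = begin
    1ℚ + toℚ k                            ≡⟨ cong (1ℚ +_) (toℚ≡mkℚ k) ⟩
    (ℤ.+ 1 ℤ.+ (ℤ.+ k) ℤ.* (ℤ.+ 1)) / 1   ≡⟨ /-cong (cong (λ i → ℤ.+ 1 ℤ.+ i) (ℤ.*-identityʳ (ℤ.+ k))) refl ⟩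
    ℤ.+ suc k / 1                         ≡⟨ ↥p/↧p≡p _ ⟩
    mkℚ (ℤ.+ suc k) 0 _                   ∎
    where open ≡-Reasoning

  1/suc≡mkℚ : ∀ d → ℤ.+ 1 / suc d ≡ mkℚ (ℤ.+ 1) d (1-coprimeTo (suc d))
  1/suc≡mkℚ d = ↥p/↧p≡p _

  toℚ-*-1/suc : ∀ d → toℚ (suc d) * (ℤ.+ 1 / suc d) ≡ 1ℚ
  toℚ-*-1/suc d = trans (cong₂ _*_ (toℚ≡mkℚ (suc d)) (1/suc≡mkℚ d))
                        (*-inverseʳ (mkℚ (ℤ.+ suc d) 0 (coprime-sym (1-coprimeTo (suc d)))))

  1/suc-nonNeg : ∀ d → 0ℚ ≤ ℤ.+ 1 / suc d
  1/suc-nonNeg d = subst (0ℚ ≤_) (sym (1/suc≡mkℚ d)) (nonNegative⁻¹ _)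

  ratioBound : ∀ d {m z} → toℚ (suc d) * m ≤ toℚ (suc (suc d)) * z → m ≤ (1ℚ + ℤ.+ 1 / suc d) * z
  ratioBound d {m} {z} dm≤[d+1]z = begin
    m                              ≡⟨ *-identityˡ m ⟨
    1ℚ * m                         ≡⟨ cong (_* m) (toℚ-*-1/suc d) ⟨
    toℚ (suc d) * r * m            ≡⟨ solve 3 (λ a b c → a :* b :* c := b :* (a :* c)) refl (toℚ (suc d)) r m ⟩
    r * (toℚ (suc d) * m)          ≤⟨ *-monoˡ-≤-nonNeg r {{nonNegative (1/suc-nonNeg d)}} dm≤[d+1]z ⟩
    r * ((1ℚ + toℚ (suc d)) * z)   ≡⟨ solve 3 (λ a b c → b :* ((con 1ℚ :+ a) :* c) := (b :+ a :* b) :* c) refl (toℚ (suc d)) r z ⟩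
    (r + toℚ (suc d) * r) * z      ≡⟨ cong (λ q → (r + q) * z) (toℚ-*-1/suc d) ⟩
    (r + 1ℚ) * z                   ≡⟨ cong (_* z) (+-comm r 1ℚ) ⟩
    (1ℚ + r) * z                   ∎
    where
    open ≤-Reasoning
    open +-*-Solver
    r = ℤ.+ 1 / suc d

  nonNeg-fraction : ∀ q → 0ℚ ≤ q → ∃[ a ] ∃[ d ] toℚ a ≡ toℚ (suc d) * q
  nonNeg-fraction q@(mkℚ (ℤ.+ a) d _) _ = a , d , sym (begin
    toℚ (suc d) * q                          ≡⟨ cong (toℚ (suc d) *_) q≡a*1/d ⟩
    toℚ (suc d) * (toℚ a * (ℤ.+ 1 / suc d))  ≡⟨ solve 3 (λ x y z → x :* (y :* z) := y :* (x :* z)) refl (toℚ (suc d)) (toℚ a) _ ⟩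
    toℚ a * (toℚ (suc d) * (ℤ.+ 1 / suc d))  ≡⟨ cong (toℚ a *_) (toℚ-*-1/suc d) ⟩
    toℚ a * 1ℚ                               ≡⟨ *-identityʳ (toℚ a) ⟩
    toℚ a                                    ∎)
    where
    open ≡-Reasoning
    open +-*-Solver
    q≡a*1/d : q ≡ toℚ a * (ℤ.+ 1 / suc d)
    q≡a*1/d = sym (begin
      toℚ a * (ℤ.+ 1 / suc d)              ≡⟨ cong₂ _*_ (toℚ≡mkℚ a) (1/suc≡mkℚ d) ⟩
      (ℤ.+ a ℤ.* ℤ.+ 1) / (1 ℕ.* suc d)    ≡⟨ /-cong (ℤ.*-identityʳ (ℤ.+ a)) (ℕ.*-identityˡ (suc d)) ⟩
      ℤ.+ a / suc d                        ≡⟨ ↥p/↧p≡p q ⟩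
      q                                    ∎)
  nonNeg-fraction q@(mkℚ ℤ.-[1+ _ ] _ _) 0≤q = contradiction (<-≤-trans (negative⁻¹ q) 0≤q) (<-irrefl refl)

  commonDenominator : ∀ {n} (x : Fin n → ℚ) → NonNeg x →
                      Σ[ D ∈ ℕ ] Σ[ X ∈ (Fin n → ℕ) ] (∀ v → toℚ (X v) ≡ toℚ (suc D) * x v)
  commonDenominator {zero}  x _  = 0 , (λ ()) , (λ ())
  commonDenominator {suc n} x nonNeg
    with a , d , a≡dx₀ ← nonNeg-fraction (x zero) (nonNeg zero)
       | D , X , X≡Dx  ← commonDenominator (λ v → x (suc v)) (λ v → nonNeg (suc v))
    = D ℕ.+ d ℕ.* suc D , X′ , X′≡D′x
    where
    open +-*-Solver
    X′ : Fin (suc n) → ℕ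
    X′ zero    = a ℕ.* suc D
    X′ (suc v) = X v ℕ.* suc d
    X′≡D′x : ∀ v → toℚ (X′ v) ≡ toℚ (suc d ℕ.* suc D) * x v
    X′≡D′x zero = begin
      toℚ (a ℕ.* suc D)                      ≡⟨ toℚ-* a (suc D) ⟩
      toℚ a * toℚ (suc D)                    ≡⟨ cong (_* toℚ (suc D)) a≡dx₀ ⟩
      toℚ (suc d) * x zero * toℚ (suc D)     ≡⟨ solve 3 (λ p q r → p :* r :* q := p :* q :* r) refl (toℚ (suc d)) (toℚ (suc D)) (x zero) ⟩
      toℚ (suc d) * toℚ (suc D) * x zero     ≡⟨ cong (_* x zero) (toℚ-* (suc d) (suc D)) ⟨
      toℚ (suc d ℕ.* suc D) * x zero         ∎
      where open ≡-Reasoning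
    X′≡D′x (suc v) = begin
      toℚ (X v ℕ.* suc d)                    ≡⟨ toℚ-* (X v) (suc d) ⟩
      toℚ (X v) * toℚ (suc d)                ≡⟨ cong (_* toℚ (suc d)) (X≡Dx v) ⟩
      toℚ (suc D) * x (suc v) * toℚ (suc d)  ≡⟨ solve 3 (λ p q r → q :* r :* p := p :* q :* r) refl (toℚ (suc d)) (toℚ (suc D)) (x (suc v)) ⟩
      toℚ (suc d) * toℚ (suc D) * x (suc v)  ≡⟨ cong (_* x (suc v)) (toℚ-* (suc d) (suc D)) ⟨
      toℚ (suc d ℕ.* suc D) * x (suc v)      ∎
      where open ≡-Reasoning

  sumFin≡sum : ∀ {n} (f : Fin n → ℚ) → sumFin f ≡ sum f
  sumFin≡sum {zero}  f = refl
  sumFin≡sum {suc n} f = cong (f zero +_) (sumFin≡sum (λ i → f (suc i)))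

  sum-mono-≤ : ∀ {n} {f g : Fin n → ℚ} → (∀ i → f i ≤ g i) → sum f ≤ sum g
  sum-mono-≤ {zero}  _  = ≤-refl
  sum-mono-≤ {suc n} le = +-mono-≤ (le zero) (sum-mono-≤ (λ i → le (suc i)))

  sum-nonNeg : ∀ {n} {f : Fin n → ℚ} → (∀ i → 0ℚ ≤ f i) → 0ℚ ≤ sum f
  sum-nonNeg {n} {f} nonNeg = subst (_≤ sum f) (sum-replicate-zero n) (sum-mono-≤ nonNeg)

  sum-const : ∀ n x → sum {n} (λ _ → x) ≡ toℚ n * x
  sum-const n x = trans (sum-replicate n) (sym (trans (×-assoc-* n 1ℚ x) (cong (n ×ℚ_) (*-identityˡ x))))

  toℚ-sumℕ : ∀ {k} (h : Fin k → ℕ) → sum (λ i → toℚ (h i)) ≡ toℚ (ℕΣ.sum h)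
  toℚ-sumℕ {zero}  h = refl
  toℚ-sumℕ {suc k} h = trans (cong (toℚ (h zero) +_) (toℚ-sumℕ (λ i → h (suc i)))) (sym (toℚ-+ (h zero) _))

  toℚ-sumBelow : ∀ k (h : ℕ → ℕ) → sum (λ (i : Fin k) → toℚ (h (toℕ i))) ≡ toℚ (sumBelow k h)
  toℚ-sumBelow zero    h = refl
  toℚ-sumBelow (suc k) h = begin
    toℚ (h 0) + sum {k} (λ i → toℚ (h (suc (toℕ i))))  ≡⟨ cong (toℚ (h 0) +_) (toℚ-sumBelow k (λ t → h (suc t))) ⟩
    toℚ (h 0) + toℚ (sumBelow k (λ t → h (suc t)))     ≡⟨ toℚ-+ (h 0) _ ⟨
    toℚ (h 0 ℕ.+ sumBelow k (λ t → h (suc t)))         ≡⟨ cong toℚ (sumBelow-suc k h) ⟨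
    toℚ (sumBelow (suc k) h)                           ∎
    where open ≡-Reasoning

  if-then-0≡*⟦_⟧ : ∀ b x → (if b then x else 0ℚ) ≡ x * toℚ ⟦ b ⟧
  if-then-0≡*⟦_⟧ true  x = sym (*-identityʳ x)
  if-then-0≡*⟦_⟧ false x = sym (*-zeroʳ x)

  sum-indicator : ∀ {n} (x : Fin n) (y : Fin n → ℚ) → sum (λ u → toℚ ⟦ does (x ≟ᶠ u) ⟧ * y u) ≡ y x
  sum-indicator {suc n} zero y = begin
    1ℚ * y zero + sum (λ u → 0ℚ * y (suc u))  ≡⟨ cong₂ _+_ (*-identityˡ (y zero)) (sum-cong-≗ {n} (λ u → *-zeroˡ (y (suc u)))) ⟩
    y zero + sum {n} (λ _ → 0ℚ)               ≡⟨ cong (y zero +_) (sum-replicate-zero n) ⟩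
    y zero + 0ℚ                               ≡⟨ +-identityʳ (y zero) ⟩
    y zero                                    ∎
    where open ≡-Reasoning
  sum-indicator {suc n} (suc x) y =
    trans (cong₂ _+_ (*-zeroˡ (y zero)) (sum-indicator x (λ u → y (suc u)))) (+-identityˡ (y (suc x)))

module Walks where

  open import Data.Nat using (ℕ; zero; suc; _+_; _*_; _∸_; _≤_; _<_; z≤n; s≤s; z<s)
  open import Data.Nat.Induction using (<-rec)
  open import Data.Nat.Properties using (≤-refl; ≤-trans; ≤-<-trans; <⇒≤; m<m+n; m≤n+m; +-monoˡ-<; +-assoc; +-comm; +-suc)
  open import Data.Fin using (Fin; zero; suc; toℕ; inject₁; fromℕ)
  open import Data.Fin.Properties using (any?)
  open import Data.Product using (Σ-syntax; ∃-syntax; _×_; _,_)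
  open import Data.Sum using (_⊎_; inj₁; inj₂)
  open import Function.Definitions using (Injective)
  open import Relation.Nullary using (yes; no; ¬_; contradiction)
  open import Relation.Binary.Definitions using (DecidableEquality)
  open import Relation.Binary.PropositionalEquality using (_≡_; refl; sym; trans; cong; subst)

  open import Defs using (Cycle; Odd; IsOddGirth)
  open Arithmetic using (Odd⇒parity≡1ℙ; Odd-+)

  infixr 5 _∷_

  data Walk {V : Set} (A : V → V → Set) : V → V → ℕ → Set where
    []  : ∀ {x} → Walk A x x 0
    _∷_ : ∀ {x y z ℓ} → A x y → Walk A y z ℓ → Walk A x z (suc ℓ)

  private
    loop+rest : ∀ a b c → a + suc b + suc c ≡ suc b + (a + suc c)
    loop+rest a b c = trans (cong (_+ suc c) (+-comm a (suc b))) (+-assoc (suc b) a (suc c))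

    loop<total : ∀ a b c → suc b < a + suc b + suc c
    loop<total a b c = ≤-<-trans (m≤n+m (suc b) a) (m<m+n (a + suc b) z<s)

    rest<total : ∀ a b c → a + suc c < a + suc b + suc c
    rest<total a b c = +-monoˡ-< (suc c) (m<m+n a z<s)

  module _ {V : Set} {A : V → V → Set} where

    infixr 5 _++_
    infixl 5 _∷ʳ_

    _++_ : ∀ {x y z a b} → Walk A x y a → Walk A y z b → Walk A x z (a + b)
    []      ++ q = q
    (e ∷ p) ++ q = e ∷ (p ++ q)

    _∷ʳ_ : ∀ {x y z a} → Walk A x y a → A y z → Walk A x z (suc a)
    []       ∷ʳ e = e ∷ []
    (e′ ∷ p) ∷ʳ e = e′ ∷ (p ∷ʳ e)

    reverse : (∀ {x y} → A x y → A y x) → ∀ {x y a} → Walk A x y a → Walk A y x a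
    reverse sym []      = []
    reverse sym (e ∷ p) = reverse sym p ∷ʳ sym e

    -- The final vertex y is not listed; for a closed walk it repeats the first one.
    vertex : ∀ {x y ℓ} → Walk A x y ℓ → Fin ℓ → V
    vertex (_∷_ {x} _ _) zero    = x
    vertex (_ ∷ p)       (suc j) = vertex p j

    vertex-step : ∀ {x y m} (p : Walk A x y (suc m)) (j : Fin m) →
                  A (vertex p (inject₁ j)) (vertex p (suc j))
    vertex-step (e ∷ _ ∷ _)       zero    = e
    vertex-step (_ ∷ p@(_ ∷ _))   (suc j) = vertex-step p j

    vertex-last : ∀ {x y m} (p : Walk A x y (suc m)) → A (vertex p (fromℕ m)) y
    vertex-last (e ∷ [])          = e
    vertex-last (_ ∷ p@(_ ∷ _))   = vertex-last p

    along : ∀ {M} (f : Fin (suc M) → V) → (∀ j → A (f (inject₁ j)) (f (suc j))) →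
            ∀ a b → toℕ a ≤ toℕ b → Walk A (f a) (f b) (toℕ b ∸ toℕ a)
    along             f step zero    zero    _         = []
    along {M = suc M} f step zero    (suc b) _         = step zero ∷ along (λ j → f (suc j)) (λ j → step (suc j)) zero b z≤n
    along {M = suc M} f step (suc a) (suc b) (s≤s a≤b) = along (λ j → f (suc j)) (λ j → step (suc j)) a b a≤b

    record Detour (x z : V) (ℓ : ℕ) : Set where
      field
        {u}        : V
        {l₁ l₂ l₃} : ℕ
        prefix     : Walk A x u l₁
        loop       : Walk A u u (suc l₂)
        suffix     : Walk A u z (suc l₃)
        length     : ℓ ≡ l₁ + suc l₂ + suc l₃

    splitAt : ∀ {y z ℓ} (p : Walk A y z ℓ) (k : Fin ℓ) →
              Σ[ b ∈ ℕ ] Walk A y (vertex p k) (toℕ k) × Walk A (vertex p k) z (suc b) × ℓ ≡ toℕ k + suc b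
    splitAt (e ∷ p) zero    = _ , [] , e ∷ p , refl
    splitAt (e ∷ p) (suc k) with b , q₁ , q₂ , eq ← splitAt p k = b , e ∷ q₁ , q₂ , cong suc eq

    module _ (_≟_ : DecidableEquality V) where

      decompose : ∀ {x z ℓ} (p : Walk A x z ℓ) → Injective _≡_ _≡_ (vertex p) ⊎ Detour x z ℓ
      decompose [] = inj₁ λ { {()} }
      decompose (_∷_ {x} e p) with any? (λ k → vertex p k ≟ x)
      ... | yes (k , refl) with b , q₁ , q₂ , eq ← splitAt p k =
        inj₂ (record { prefix = [] ; loop = e ∷ q₁ ; suffix = q₂ ; length = cong suc eq })
      ... | no ¬repeat with decompose p
      ...   | inj₂ d = inj₂ (record { prefix = e ∷ Detour.prefix d ; loop = Detour.loop d
                                    ; suffix = Detour.suffix d ; length = cong suc (Detour.length d) })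
      ...   | inj₁ injective = inj₁ injective′
        where
        injective′ : Injective _≡_ _≡_ (vertex (e ∷ p))
        injective′ {zero}  {zero}  _  = refl
        injective′ {zero}  {suc j} eq = contradiction (j , sym eq) ¬repeat
        injective′ {suc i} {zero}  eq = contradiction (i , eq) ¬repeat
        injective′ {suc i} {suc j} eq = cong suc (injective eq)

      module _ (irreflexive : ∀ {x} → ¬ A x x) where

        closedWalk⇒cycle : ∀ {x m} (p : Walk A x x (suc m)) → Odd (suc m) →
                           Injective _≡_ _≡_ (vertex p) → Cycle A (suc m)
        closedWalk⇒cycle {m = zero}        (e ∷ [])  _   _         = contradiction e irreflexive
        closedWalk⇒cycle {m = suc zero}    _         odd _ with () ← Odd⇒parity≡1ℙ odd
        closedWalk⇒cycle {m = suc (suc m)} p@(_ ∷ _) _   injective = record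
          { m = suc (suc m) ; len = refl ; long = s≤s (s≤s (s≤s z≤n))
          ; w = vertex p ; distinct = injective ; step = vertex-step p ; close = vertex-last p }

        shorterOddClosedWalk : ∀ {x L} → Detour x x L → Odd L →
                               ∃[ y ] Σ[ L′ ∈ ℕ ] (L′ < L × Odd L′ × Walk A y y L′)
        shorterOddClosedWalk record { l₁ = a ; l₂ = b ; l₃ = c ; prefix = q₁ ; loop = loop ; suffix = q₂ ; length = refl } odd
          with Odd-+ (suc b) (a + suc c) (subst Odd (loop+rest a b c) odd)
        ... | inj₁ oddLoop = _ , _ , loop<total a b c , oddLoop , loop
        ... | inj₂ oddRest = _ , _ , rest<total a b c , oddRest , q₁ ++ q₂

        oddClosedWalk⇒oddCycle : ∀ {x L} → Walk A x x L → Odd L → ∃[ k ] (Odd k × k ≤ L × Cycle A k)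
        oddClosedWalk⇒oddCycle {L = L} = <-rec Motive shorten L
          where
          Motive : ℕ → Set
          Motive L = ∀ {x} → Walk A x x L → Odd L → ∃[ k ] (Odd k × k ≤ L × Cycle A k)
          shorten : ∀ L → (∀ {L′} → L′ < L → Motive L′) → Motive L
          shorten zero    _   _ (_ , ())
          shorten (suc m) rec p odd with decompose p
          ... | inj₁ injective = suc m , odd , ≤-refl , closedWalk⇒cycle p odd injective
          ... | inj₂ detour
            with _ , L′ , L′<L , odd′ , p′ ← shorterOddClosedWalk detour odd
            with k , oddk , k≤L′ , cycle ← rec L′<L p′ odd′
            = k , oddk , ≤-trans k≤L′ (<⇒≤ L′<L) , cycle

        oddGirth-≤-closedWalk : ∀ {g x L} → IsOddGirth A g → Walk A x x L → Odd L → g ≤ L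
        oddGirth-≤-closedWalk (_ , _ , minimal) p odd
          with k , oddk , k≤L , cycle ← oddClosedWalk⇒oddCycle p odd
          = ≤-trans (minimal k oddk cycle) k≤L

  oddGirth-shape : ∀ {V : Set} {A : V → V → Set} {ρ} → IsOddGirth A (2 * ρ ∸ 1) →
                   ∃[ K ] (ρ ≡ suc (suc K) × IsOddGirth A (suc (2 * suc K)))
  oddGirth-shape {ρ = zero}        (_ , cycle , _) with () ← Cycle.long cycle
  oddGirth-shape {ρ = suc zero}    (_ , cycle , _) with s≤s () ← Cycle.long cycle
  oddGirth-shape {A = A} {suc (suc K)} girth = K , refl , subst (IsOddGirth A) (+-suc (suc K) (suc K + 0)) girth

module Contraction where

  open import Data.Nat using (_≤_)
  open import Data.Fin using (Fin)
  open import Data.Fin.Properties using (_≟_)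
  open import Data.Maybe using (Maybe; just; nothing)
  open import Data.Maybe.Properties using (just-injective) renaming (≡-dec to ≡-dec-Maybe)
  open import Data.Product using (_×_; _,_)
  open import Data.Sum using (_⊎_; inj₁; inj₂)
  open import Function.Bundles using (_⇔_; Equivalence)
  open import Relation.Nullary using (¬_; yes; no; contradiction)
  open import Relation.Binary.PropositionalEquality using (_≡_; refl; sym; trans; cong; subst; subst₂)

  open import Defs hiding (sym)
  open Walks

  module _ {n k} (G : Graph n) (c : Fin n → Fin k) (i : Fin k) where

    private
      π : Fin n → Maybe (Fin n)
      π = contractMap c i

    contractMap-colour : ∀ {u} → c u ≡ i → π u ≡ nothing
    contractMap-colour {u} cu≡i with c u ≟ i
    ... | yes _    = refl
    ... | no cu≢i = contradiction cu≡i cu≢i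

    contractMap-≡ : ∀ u v → π u ≡ π v → (c u ≡ i × c v ≡ i) ⊎ u ≡ v
    contractMap-≡ u v πu≡πv with c u ≟ i | c v ≟ i
    ... | yes cu≡i | yes cv≡i = inj₁ (cu≡i , cv≡i)
    ... | no _     | no _     = inj₂ (just-injective πu≡πv)
    ... | yes _    | no _     with () ← πu≡πv
    ... | no _     | yes _    with () ← πu≡πv

    ContractAdj-irreflexive : ProperColoring G k c → ∀ {x} → ¬ ContractAdj G c i x x
    ContractAdj-irreflexive proper (u , v , e , refl , πv≡πu) with contractMap-≡ u v (sym πv≡πu)
    ... | inj₁ (cu≡i , cv≡i) = proper u v e (trans cu≡i (sym cv≡i))
    ... | inj₂ refl          = irrefl G e

    contractWalk : ∀ {u v L} → Walk (Adj G) u v L → Walk (ContractAdj G c i) (π u) (π v) L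
    contractWalk []                    = []
    contractWalk (_∷_ {x} {y} e p) = (x , y , e , refl , refl) ∷ contractWalk p

    oddGirth-≤-walk : ProperColoring G k c → ∀ {g u v L} → IsOddGirth (ContractAdj G c i) g →
                      π u ≡ π v → Walk (Adj G) u v L → Odd L → g ≤ L
    oddGirth-≤-walk proper {L = L} girth πu≡πv p =
      oddGirth-≤-closedWalk (≡-dec-Maybe _≟_) (ContractAdj-irreflexive proper) girth
        (subst (λ y → Walk (ContractAdj G c i) _ y L) (sym πu≡πv) (contractWalk p))

    module Singleton {v₀ : Fin n} (singleton : ∀ u → (c u ≡ i) ⇔ (u ≡ v₀)) where

      expand : Maybe (Fin n) → Fin n
      expand nothing  = v₀
      expand (just u) = u

      expand-contractMap : ∀ u → expand (π u) ≡ u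
      expand-contractMap u with c u ≟ i
      ... | yes cu≡i = sym (Equivalence.to (singleton u) cu≡i)
      ... | no _     = refl

      contractMap-expand : ∀ u {x} → π u ≡ x → π (expand x) ≡ x
      contractMap-expand u refl = cong π (expand-contractMap u)

      expand-adjacent : ∀ {x y} → ContractAdj G c i x y → Adj G (expand x) (expand y)
      expand-adjacent (u , v , e , refl , refl) = subst₂ (Adj G) (sym (expand-contractMap u)) (sym (expand-contractMap v)) e

module CycleGraph where

  open import Data.Nat as ℕ using (ℕ; zero; suc; _+_; _*_; _∸_; _%_; _≤_; _<_; s≤s; NonZero; >-nonZero⁻¹)
  open import Data.Nat.DivMod using (%-distribˡ-+; m%n%n≡m%n; m%n<n; m<n⇒m%n≡m; n%n≡0)
  open import Data.Nat.Properties as ℕ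
    using ( ≤-antisym; ≤-trans; <-cmp; ≮⇒≥; <⇒≱; n≤1+n; n≤0⇒n≡0; n≢0⇒n>0; m≤m+n
          ; +-identityʳ; +-suc; +-cancelˡ-≡; m+n∸n≡m; +-∸-assoc; *-monoʳ-<)
  open import Data.Fin using (Fin; zero; suc; toℕ; punchOut)
  open import Data.Fin.Properties using (any?; punchOut-injective) renaming (_≟_ to _≟ᶠ_)
  open import Data.Parity.Base as ℙ using (Parity; 0ℙ; 1ℙ; _⁻¹)
  open import Data.Parity.Properties using (+-homo-+; *-homo-*) renaming (_≟_ to _≟ᵖ_)
  open import Data.Bool using (not)
  open import Data.Empty using (⊥; ⊥-elim)
  open import Data.Product using (∃-syntax; _×_; _,_)
  open import Function using (_∘_)
  open import Relation.Nullary using (Dec; does; yes; no; contradiction; _×-dec_)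
  open import Relation.Binary.Definitions using (tri<; tri≈; tri>)
  open import Relation.Binary.PropositionalEquality using (_≡_; _≢_; refl; sym; trans; cong; cong₂; subst; subst₂; module ≡-Reasoning)

  open import Defs hiding (sym)
  open Arithmetic using (least; least-≤; least-minimal; least-satisfies; sumBelow; ⟦_⟧; isOdd; sumBelow-rotate; count-odd; count-complement)
  open Walks

  data CyclicAdj (g : ℕ) .{{_ : NonZero g}} (p q : ℕ) : Set where
    forward  : suc p % g ≡ q % g → CyclicAdj g p q
    backward : suc q % g ≡ p % g → CyclicAdj g p q

  module _ {g : ℕ} .{{_ : NonZero g}} where

    CyclicAdj-sym : ∀ {p q} → CyclicAdj g p q → CyclicAdj g q p
    CyclicAdj-sym (forward e) = backward e
    CyclicAdj-sym (backward e) = forward e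

    %-cong-+ : ∀ {a b c d} → a % g ≡ b % g → c % g ≡ d % g → (a + c) % g ≡ (b + d) % g
    %-cong-+ {a} {b} {c} {d} a≡b c≡d =
      trans (%-distribˡ-+ a c g) (trans (cong₂ (λ x y → (x + y) % g) a≡b c≡d) (sym (%-distribˡ-+ b d g)))

    CyclicAdj-shift : ∀ {p q} t → CyclicAdj g p q → CyclicAdj g (p + t) (q + t)
    CyclicAdj-shift t (forward e) = forward (%-cong-+ e refl)
    CyclicAdj-shift t (backward e) = backward (%-cong-+ e refl)

    suc-% : ∀ p → suc p % g ≡ suc (p % g) % g
    suc-% p = %-cong-+ {1} {1} refl (sym (m%n%n≡m%n p g))

    oddResidues-independent : ∀ {p q} → CyclicAdj g p q → ℕ.parity (p % g) ≡ 1ℙ → ℕ.parity (q % g) ≡ 1ℙ → ⊥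
    oddResidues-independent (backward e) odd-p odd-q = oddResidues-independent (forward e) odd-q odd-p
    oddResidues-independent {p} {q} (forward e) odd-p odd-q with suc (p % g) ℕ.<? g
    ... | yes r+1<g = contradiction (begin
            1ℙ                        ≡⟨ odd-q ⟨
            ℕ.parity (q % g)          ≡⟨ cong ℕ.parity (trans (sym e) (trans (suc-% p) (m<n⇒m%n≡m r+1<g))) ⟩
            ℕ.parity (suc (p % g))    ≡⟨ +-homo-+ 1 (p % g) ⟩
            ℕ.parity (p % g) ⁻¹       ≡⟨ cong _⁻¹ odd-p ⟩
            0ℙ                        ∎) (λ ())
      where open ≡-Reasoning
    ... | no r+1≮g = contradiction (trans (sym odd-q) (cong ℕ.parity (trans (sym e) (trans (suc-% p) wraps)))) (λ ())
      where
      wraps : suc (p % g) % g ≡ 0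
      wraps = trans (cong (_% g) (≤-antisym (m%n<n p g) (≮⇒≥ r+1≮g))) (n%n≡0 g)

  module OddCycleGraph (K : ℕ) where

    g : ℕ
    g = suc (2 * K)

    1+g≡2[1+K] : suc g ≡ suc K + suc K
    1+g≡2[1+K] = cong suc (trans (cong (λ m → suc (K + m)) (+-identityʳ K)) (sym (+-suc K K)))

    signed : Parity → ℕ → ℕ
    signed 0ℙ d = d
    signed 1ℙ d = g ∸ d

    g∸K≡1+K : g ∸ K ≡ suc K
    g∸K≡1+K = trans (cong (λ m → suc (K + m) ∸ K) (+-identityʳ K)) (m+n∸n≡m (suc K) K)

    signed-step : ∀ s d → d < g → CyclicAdj g (signed s d) (signed s (suc d))
    signed-step 0ℙ d _   = forward refl
    signed-step 1ℙ d d<g = backward (cong (_% g) (sym (+-∸-assoc 1 d<g)))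

    signed-middle : ∀ s → CyclicAdj g (signed s K) (signed (s ⁻¹) K)
    signed-middle 0ℙ = forward (cong (_% g) (sym g∸K≡1+K))
    signed-middle 1ℙ = backward (cong (_% g) (sym g∸K≡1+K))

    signed-origin : ∀ s → CyclicAdj g 0 (signed s 1)
    signed-origin 0ℙ = forward refl
    signed-origin 1ℙ = backward (n%n≡0 g)

    count-odd-below : sumBelow g (λ t → ⟦ isOdd t ⟧) ≡ K
    count-odd-below = begin
      sumBelow (K + (K + 0)) (λ t → ⟦ isOdd t ⟧) + ⟦ isOdd (2 * K) ⟧
        ≡⟨ cong₂ _+_ (trans (cong (λ m → sumBelow (K + m) _) (+-identityʳ K)) (count-odd K))
                     (cong (λ q → ⟦ does (q ≟ᵖ 1ℙ) ⟧) (*-homo-* 2 K)) ⟩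
      K + 0
        ≡⟨ +-identityʳ K ⟩
      K ∎
      where open ≡-Reasoning

    count-even-below : sumBelow g (λ t → ⟦ not (isOdd t) ⟧) ≡ suc K
    count-even-below = +-cancelˡ-≡ K _ _ (begin
      K + sumBelow g (λ t → ⟦ not (isOdd t) ⟧)                          ≡⟨ cong (_+ sumBelow g (λ t → ⟦ not (isOdd t) ⟧)) count-odd-below ⟨
      sumBelow g (λ t → ⟦ isOdd t ⟧) + sumBelow g (λ t → ⟦ not (isOdd t) ⟧) ≡⟨ count-complement g isOdd ⟩
      suc (K + (K + 0))                                                 ≡⟨ cong (λ m → suc (K + m)) (+-identityʳ K) ⟩
      suc (K + K)                                                       ≡⟨ +-suc K K ⟨
      K + suc K                                                         ∎)
      where open ≡-Reasoning

    count-evenResidues : ∀ p → sumBelow g (λ t → ⟦ not (isOdd ((p + t) % g)) ⟧) ≡ suc K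
    count-evenResidues p = trans (sumBelow-rotate g (λ r → ⟦ not (isOdd r) ⟧) p) count-even-below

  module Layering {n} (G : Graph n) (adjacent? : ∀ u v → Dec (Adj G u v))
                  (c : Fin n → Fin 3) (proper : ProperColoring G 3 c) (i : Fin 3)
                  (K : ℕ) .{{_ : NonZero K}}
                  (longOddWalks : ∀ {a b L} → c a ≡ i → c b ≡ i → Walk (Adj G) a b L → Odd L → suc (2 * K) ≤ L)
                  where

    open OddCycleGraph K

    Reach : ℕ → Fin n → Set
    Reach zero    v = c v ≡ i
    Reach (suc ℓ) v = ∃[ u ] (Adj G v u × Reach ℓ u)

    reach? : ∀ ℓ v → Dec (Reach ℓ v)
    reach? zero    v = c v ≟ᶠ i
    reach? (suc ℓ) v = any? (λ u → adjacent? v u ×-dec reach? ℓ u)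

    reach⇒walk : ∀ ℓ {v} → Reach ℓ v → ∃[ a ] (c a ≡ i × Walk (Adj G) v a ℓ)
    reach⇒walk zero    {v} cv≡i      = v , cv≡i , []
    reach⇒walk (suc ℓ) (u , e , r) with a , ca≡i , p ← reach⇒walk ℓ r = a , ca≡i , e ∷ p

    dist : Fin n → ℕ
    dist v = least (λ ℓ → reach? ℓ v) K

    dist-≤ : ∀ v → dist v ≤ K
    dist-≤ v = least-≤ (λ ℓ → reach? ℓ v) K

    dist-minimal : ∀ {ℓ v} → Reach ℓ v → dist v ≤ ℓ
    dist-minimal {v = v} = least-minimal (λ ℓ → reach? ℓ v) K

    dist-reach : ∀ {v} → dist v < K → Reach (dist v) v
    dist-reach {v} = least-satisfies (λ ℓ → reach? ℓ v) K

    dist<g : ∀ v → dist v < g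
    dist<g v = s≤s (≤-trans (dist-≤ v) (m≤m+n K (K + 0)))

    dist-step : ∀ {u v} → Adj G u v → dist v ≤ suc (dist u)
    dist-step {u} {v} e with dist u ℕ.<? K
    ... | yes du<K = dist-minimal (u , Graph.sym G e , dist-reach du<K)
    ... | no  du≮K = ≤-trans (dist-≤ v) (≤-trans (≮⇒≥ du≮K) (n≤1+n (dist u)))

    dist-colour : ∀ {u} → c u ≡ i → dist u ≡ 0
    dist-colour cu≡i = n≤0⇒n≡0 (dist-minimal {0} cu≡i)

    dist-zero : ∀ {v} → dist v ≡ 0 → c v ≡ i
    dist-zero {v} dv≡0 = subst (λ ℓ → Reach ℓ v) dv≡0 (dist-reach (subst (_< K) (sym dv≡0) (>-nonZero⁻¹ K)))

    noEdgeInLowLayer : ∀ {u v} → Adj G u v → dist u ≡ dist v → dist u < K → ⊥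
    noEdgeInLowLayer {u} {v} e du≡dv du<K
      with a , ca≡i , p ← reach⇒walk (dist u) (dist-reach du<K)
         | b , cb≡i , q ← reach⇒walk (dist u) (subst (λ ℓ → Reach ℓ v) (sym du≡dv) (dist-reach (subst (_< K) du≡dv du<K)))
      = <⇒≱ short (longOddWalks ca≡i cb≡i (reverse (Graph.sym G) p ++ e ∷ q) (d , odd))
      where
      d = dist u
      odd : d + suc d ≡ suc (2 * d)
      odd = trans (+-suc d d) (cong (λ m → suc (d + m)) (sym (+-identityʳ d)))
      short : d + suc d < g
      short = subst (_< g) (sym odd) (s≤s (*-monoʳ-< 2 du<K))

    -- Which of the two colours other than i the vertex has.
    side : Fin n → Parity
    side v with i ≟ᶠ c v
    ... | yes _   = 0ℙ
    ... | no i≢cv = ℕ.parity (toℕ (punchOut i≢cv))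

    side-colour : ∀ {u} → c u ≡ i → side u ≡ 0ℙ
    side-colour {u} cu≡i with i ≟ᶠ c u
    ... | yes _    = refl
    ... | no i≢cu = contradiction (sym cu≡i) i≢cu

    side-flip : ∀ {u v} → Adj G u v → c u ≢ i → c v ≢ i → side u ≡ side v ⁻¹
    side-flip {u} {v} e cu≢i cv≢i with i ≟ᶠ c u | i ≟ᶠ c v
    ... | yes i≡cu | _        = contradiction (sym i≡cu) cu≢i
    ... | no _     | yes i≡cv = contradiction (sym i≡cv) cv≢i
    ... | no i≢cu  | no i≢cv  = opposite (punchOut i≢cu) (punchOut i≢cv) (proper u v e ∘ punchOut-injective i≢cu i≢cv)
      where
      opposite : (x y : Fin 2) → x ≢ y → ℕ.parity (toℕ x) ≡ ℕ.parity (toℕ y) ⁻¹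
      opposite zero       zero       x≢y = contradiction refl x≢y
      opposite zero       (suc zero) _   = refl
      opposite (suc zero) zero       _   = refl
      opposite (suc zero) (suc zero) x≢y = contradiction refl x≢y

    -- Between consecutive layers outside colour class i both summands flip, so the sign is kept;
    -- within layer K only the side flips, sending the two ends of an edge to K and g ∸ K = K + 1.
    sign : Fin n → Parity
    sign v = ℕ.parity (dist v) ℙ.+ side v

    pos : Fin n → ℕ
    pos v = signed (sign v) (dist v)

    pos-colour : ∀ {u} → c u ≡ i → pos u ≡ 0
    pos-colour {u} cu≡i = cong₂ (λ d s → signed (ℕ.parity d ℙ.+ s) d) (dist-colour cu≡i) (side-colour cu≡i)

    private
      ⁻¹+⁻¹ : ∀ p q → p ⁻¹ ℙ.+ q ⁻¹ ≡ p ℙ.+ q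
      ⁻¹+⁻¹ 0ℙ 0ℙ = refl
      ⁻¹+⁻¹ 0ℙ 1ℙ = refl
      ⁻¹+⁻¹ 1ℙ 0ℙ = refl
      ⁻¹+⁻¹ 1ℙ 1ℙ = refl

      +⁻¹ : ∀ p q → p ℙ.+ q ⁻¹ ≡ (p ℙ.+ q) ⁻¹
      +⁻¹ 0ℙ q = refl
      +⁻¹ 1ℙ q = refl

    fromColourClass : ∀ {u v} → Adj G u v → c u ≡ i → CyclicAdj g (pos u) (pos v)
    fromColourClass {u} {v} e cu≡i =
      subst₂ (CyclicAdj g) (sym (pos-colour cu≡i)) (cong (λ d → signed (ℕ.parity d ℙ.+ side v) d) (sym dv≡1))
             (signed-origin (ℕ.parity 1 ℙ.+ side v))
      where
      dv≡1 : dist v ≡ 1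
      dv≡1 = ≤-antisym (subst (λ d → dist v ≤ suc d) (dist-colour cu≡i) (dist-step e))
                       (n≢0⇒n>0 (λ dv≡0 → proper u v e (trans cu≡i (sym (dist-zero dv≡0)))))

    consecutiveLayers : ∀ {u v} → Adj G u v → c u ≢ i → c v ≢ i → dist v ≡ suc (dist u) →
                        CyclicAdj g (pos u) (pos v)
    consecutiveLayers {u} {v} e cu≢i cv≢i dv≡1+du =
      subst (CyclicAdj g (pos u)) (sym (cong₂ signed sv≡su dv≡1+du)) (signed-step (sign u) (dist u) (dist<g u))
      where
      sv≡su : sign v ≡ sign u
      sv≡su = begin
        ℕ.parity (dist v) ℙ.+ side v           ≡⟨ cong₂ ℙ._+_ (cong ℕ.parity dv≡1+du) (side-flip (Graph.sym G e) cv≢i cu≢i) ⟩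
        ℕ.parity (suc (dist u)) ℙ.+ side u ⁻¹  ≡⟨ cong (ℙ._+ side u ⁻¹) (+-homo-+ 1 (dist u)) ⟩
        ℕ.parity (dist u) ⁻¹ ℙ.+ side u ⁻¹     ≡⟨ ⁻¹+⁻¹ (ℕ.parity (dist u)) (side u) ⟩
        sign u                                 ∎
        where open ≡-Reasoning

    topLayer : ∀ {u v} → Adj G u v → c u ≢ i → c v ≢ i → dist u ≡ K → dist v ≡ K →
               CyclicAdj g (pos u) (pos v)
    topLayer {u} {v} e cu≢i cv≢i du≡K dv≡K =
      subst₂ (CyclicAdj g) (sym (cong (signed (sign u)) du≡K)) (sym (cong₂ signed sv≡su⁻¹ dv≡K)) (signed-middle (sign u))
      where
      sv≡su⁻¹ : sign v ≡ sign u ⁻¹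
      sv≡su⁻¹ = begin
        ℕ.parity (dist v) ℙ.+ side v        ≡⟨ cong₂ ℙ._+_ (cong ℕ.parity (trans dv≡K (sym du≡K))) (side-flip (Graph.sym G e) cv≢i cu≢i) ⟩
        ℕ.parity (dist u) ℙ.+ side u ⁻¹     ≡⟨ +⁻¹ (ℕ.parity (dist u)) (side u) ⟩
        sign u ⁻¹                           ∎
        where open ≡-Reasoning

    pos-homomorphism : ∀ {u v} → Adj G u v → CyclicAdj g (pos u) (pos v)
    pos-homomorphism {u} {v} e with c u ≟ᶠ i | c v ≟ᶠ i
    ... | yes cu≡i | _        = fromColourClass e cu≡i
    ... | no _     | yes cv≡i = CyclicAdj-sym (fromColourClass (Graph.sym G e) cv≡i)
    ... | no cu≢i  | no cv≢i  with <-cmp (dist u) (dist v)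
    ...   | tri< du<dv _ _ = consecutiveLayers e cu≢i cv≢i (≤-antisym (dist-step e) du<dv)
    ...   | tri> _ _ dv<du = CyclicAdj-sym (consecutiveLayers (Graph.sym G e) cv≢i cu≢i (≤-antisym (dist-step (Graph.sym G e)) dv<du))
    ...   | tri≈ _ du≡dv _ with dist u ℕ.<? K
    ...     | yes du<K = ⊥-elim (noEdgeInLowLayer e du≡dv du<K)
    ...     | no  du≮K = topLayer e cu≢i cv≢i du≡K (trans (sym du≡dv) du≡K)
      where du≡K = ≤-antisym (dist-≤ u) (≮⇒≥ du≮K)

module ThresholdRounding where

  open import Data.Nat as ℕ using (ℕ; suc; _∸_; z≤n; _<?_; _≤?_)
  import Data.Nat.Properties as ℕ
  open import Data.Fin using (Fin; toℕ)
  open import Data.Bool using (Bool; true; false; not; _∧_; _∨_; if_then_else_)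
  open import Data.Bool.Properties using (∨-zeroʳ; ¬-not) renaming (_≟_ to _≟ᵇ_)
  open import Data.Empty using (⊥; ⊥-elim)
  open import Data.Rational using (ℚ; 0ℚ; 1ℚ; _+_; _*_; _≤_; positive; nonNegative)
  open import Data.Rational.Properties using (*-monoˡ-≤-nonNeg; *-cancelˡ-≤-pos; *-identityʳ; *-distribˡ-+; module ≤-Reasoning)
  open import Data.Rational.Solver using (module +-*-Solver)
  open import Data.Product using (_,_)
  open import Data.Sum using (inj₁; inj₂)
  open import Algebra.Properties.CommutativeSemigroup ℕ.+-commutativeSemigroup using (interchange)
  open import Relation.Nullary using (Dec; yes; no; does; ¬_; contradiction)
  open import Relation.Nullary.Decidable using (dec-true; dec-false)
  open import Relation.Binary.PropositionalEquality using (_≡_; refl; sym; trans; cong; cong₂; module ≡-Reasoning)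

  open import Defs hiding (sym)
  open Arithmetic
  open Rationals

  coverWeight-doubleCounting : ∀ {n} D N (w : Fin n → ℚ) (C : ℕ → ℕ → Fin n → Bool) →
    sum {D} (λ j → sum {N} (λ t → coverWeight w (C (toℕ j) (toℕ t)))) ≡
    sum (λ v → w v * toℚ (sumBelow D (λ j → sumBelow N (λ t → ⟦ C j t v ⟧))))
  coverWeight-doubleCounting {n} D N w C = begin
    sum {D} (λ j → sum {N} (λ t → coverWeight w (C′ j t)))
      ≡⟨ sum-cong-≗ {D} (λ j → sum-cong-≗ {N} (λ t → trans (sumFin≡sum {n} (λ v → if C′ j t v then w v else 0ℚ))
                                                            (sum-cong-≗ {n} (λ v → if-then-0≡*⟦ C′ j t v ⟧ (w v))))) ⟩
    sum {D} (λ j → sum {N} (λ t → sum {n} (λ v → w v * indicator j t v)))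
      ≡⟨ sum-cong-≗ {D} (λ j → ∑-comm (λ t v → w v * indicator j t v)) ⟩
    sum {D} (λ j → sum {n} (λ v → sum {N} (λ t → w v * indicator j t v)))
      ≡⟨ ∑-comm (λ j v → sum {N} (λ t → w v * indicator j t v)) ⟩
    sum {n} (λ v → sum {D} (λ j → sum {N} (λ t → w v * indicator j t v)))
      ≡⟨ sum-cong-≗ {n} (λ v → sum-cong-≗ {D} (λ j → *-distribˡ-sum (w v) (λ t → indicator j t v))) ⟨
    sum {n} (λ v → sum {D} (λ j → w v * sum {N} (λ t → indicator j t v)))
      ≡⟨ sum-cong-≗ {n} (λ v → *-distribˡ-sum (w v) (λ j → sum {N} (λ t → indicator j t v))) ⟨
    sum {n} (λ v → w v * sum {D} (λ j → sum {N} (λ t → indicator j t v)))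
      ≡⟨ sum-cong-≗ {n} (λ v → cong (w v *_) (trans (sum-cong-≗ {D} (λ j → toℚ-sumBelow N (λ t → ⟦ C (toℕ j) t v ⟧)))
                                                     (toℚ-sumBelow D (λ j → sumBelow N (λ t → ⟦ C j t v ⟧))))) ⟩
    sum {n} (λ v → w v * toℚ (sumBelow D (λ j → sumBelow N (λ t → ⟦ C j t v ⟧))))
      ∎
    where
    open ≡-Reasoning
    C′ : Fin D → Fin N → Fin n → Bool
    C′ j t = C (toℕ j) (toℕ t)
    indicator : Fin D → Fin N → Fin n → ℚ
    indicator j t v = toℚ ⟦ C′ j t v ⟧

  scaledObjective : ∀ {n} (w x : Fin n → ℚ) D (X : Fin n → ℕ) → (∀ v → toℚ (X v) ≡ toℚ D * x v) →
                    ∀ k → sum (λ v → w v * toℚ (k ℕ.* X v)) ≡ toℚ D * (toℚ k * objective w x)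
  scaledObjective {n} w x D X X≡Dx k = begin
    sum (λ v → w v * toℚ (k ℕ.* X v))             ≡⟨ sum-cong-≗ {n} (λ v → trans (cong (w v *_) (trans (toℚ-* k (X v)) (cong (toℚ k *_) (X≡Dx v))))
                                                                                 (reorder (w v) (toℚ k) (toℚ D) (x v))) ⟩
    sum (λ v → toℚ D * (toℚ k * (w v * x v)))     ≡⟨ *-distribˡ-sum (toℚ D) (λ v → toℚ k * (w v * x v)) ⟨
    toℚ D * sum (λ v → toℚ k * (w v * x v))       ≡⟨ cong (toℚ D *_) (*-distribˡ-sum (toℚ k) (λ v → w v * x v)) ⟨
    toℚ D * (toℚ k * sum (λ v → w v * x v))       ≡⟨ cong (λ s → toℚ D * (toℚ k * s)) (sumFin≡sum (λ v → w v * x v)) ⟨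
    toℚ D * (toℚ k * objective w x)               ∎
    where
    open ≡-Reasoning
    open +-*-Solver
    reorder : ∀ a b c d → a * (b * (c * d)) ≡ c * (b * (a * d))
    reorder = solve 4 (λ a b c d → a :* (b :* (c :* d)) := c :* (b :* (a :* d))) refl

  scaledFeasible : ∀ {n} {x : Fin n → ℚ} {D} {X : Fin n → ℕ} → (∀ v → toℚ (X v) ≡ toℚ D * x v) →
                   ∀ {u v} → 1ℚ ≤ x u + x v → D ℕ.≤ X u ℕ.+ X v
  scaledFeasible {x = x} {D} {X} X≡Dx {u} {v} 1≤xu+xv = toℚ-cancel-≤ (begin
    toℚ D                       ≡⟨ *-identityʳ (toℚ D) ⟨
    toℚ D * 1ℚ                  ≤⟨ *-monoˡ-≤-nonNeg (toℚ D) {{nonNegative (toℚ-nonNeg D)}} 1≤xu+xv ⟩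
    toℚ D * (x u + x v)         ≡⟨ *-distribˡ-+ (toℚ D) (x u) (x v) ⟩
    toℚ D * x u + toℚ D * x v   ≡⟨ cong₂ _+_ (X≡Dx u) (X≡Dx v) ⟨
    toℚ (X u) + toℚ (X v)       ≡⟨ toℚ-+ (X u) (X v) ⟨
    toℚ (X u ℕ.+ X v)           ∎)
    where open ≤-Reasoning

  module _ {n} (G : Graph n) {N l : ℕ} (N≤l+l : N ℕ.≤ l ℕ.+ l)
           (I : ℕ → Fin n → Bool)
           (I-independent : ∀ t {u v} → Adj G u v → I t u ≡ true → I t v ≡ true → ⊥)
           (I-misses-≤ : ∀ v → sumBelow N (λ t → ⟦ not (I t v) ⟧) ℕ.≤ l) where

    module ThresholdCovers (D : ℕ) (X : Fin n → ℕ) (feasible : ∀ {u v} → Adj G u v → D ℕ.≤ X u ℕ.+ X v) where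

      a : Fin n → ℕ
      a v = X v ℕ.+ X v

      high? : ∀ j v → Dec ((D ℕ.+ D) ∸ a v ℕ.≤ j)
      high? j v = (D ℕ.+ D) ∸ a v ≤? j

      nonLow? : ∀ j v → Dec (j ℕ.< a v)
      nonLow? j v = j <? a v

      high nonLow : ℕ → Fin n → Bool
      high   j v = does (high? j v)
      nonLow j v = does (nonLow? j v)

      -- With xᵥ = X v / D: high ⇔ xᵥ ≥ 1 − j/2D and nonLow ⇔ xᵥ > j/2D.
      cover : ℕ → ℕ → Fin n → Bool
      cover j t v = high j v ∨ (nonLow j v ∧ not (I t v))

      module _ {j t : ℕ} {v : Fin n} where

        cover-high : high j v ≡ true → cover j t v ≡ true
        cover-high h = cong (_∨ (nonLow j v ∧ not (I t v))) h

        cover-missed : nonLow j v ≡ true → I t v ≡ false → cover j t v ≡ true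
        cover-missed nl ¬I = trans (cong₂ (λ x y → high j v ∨ (x ∧ not y)) nl ¬I) (∨-zeroʳ (high j v))

        cover-middle : high j v ≡ false → nonLow j v ≡ true → cover j t v ≡ not (I t v)
        cover-middle ¬h nl = cong₂ (λ x y → x ∨ (y ∧ not (I t v))) ¬h nl

        cover-low : high j v ≡ false → nonLow j v ≡ false → cover j t v ≡ false
        cover-low ¬h ¬nl = cong₂ (λ x y → x ∨ (y ∧ not (I t v))) ¬h ¬nl

      lowNeighbour⇒high : ∀ {j u v} → Adj G u v → ¬ (j ℕ.< a u) → (D ℕ.+ D) ∸ a v ℕ.≤ j
      lowNeighbour⇒high {j} {u} {v} e j≮au = ℕ.≤-trans (ℕ.m≤n+o⇒m∸n≤o (D ℕ.+ D) (a v) 2D≤av+au) (ℕ.≮⇒≥ j≮au)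
        where
        2D≤av+au : D ℕ.+ D ℕ.≤ a v ℕ.+ a u
        2D≤av+au = ℕ.≤-trans (ℕ.+-mono-≤ (feasible e) (feasible e))
                    (ℕ.≤-reflexive (trans (interchange (X u) (X v) (X u) (X v)) (ℕ.+-comm (a u) (a v))))

      high⇒nonLow : ∀ {j v} → j ℕ.< D → (D ℕ.+ D) ∸ a v ℕ.≤ j → j ℕ.< a v
      high⇒nonLow {j} {v} j<D h = ℕ.<-trans j<D (ℕ.+-cancelʳ-< D D (a v) (ℕ.≤-<-trans 2D≤a+j (ℕ.+-monoʳ-< (a v) j<D)))
        where
        2D≤a+j : D ℕ.+ D ℕ.≤ a v ℕ.+ j
        2D≤a+j = ℕ.≤-trans (ℕ.m≤n+m∸n (D ℕ.+ D) (a v)) (ℕ.+-monoʳ-≤ (a v) h)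

      cover-isVertexCover : ∀ j t → VertexCover G (cover j t)
      cover-isVertexCover j t u v e with high? j u | high? j v
      ... | yes hu | _      = inj₁ (cover-high (dec-true (high? j u) hu))
      ... | no _   | yes hv = inj₂ (cover-high (dec-true (high? j v) hv))
      ... | no ¬hu | no ¬hv with nonLow? j u | nonLow? j v
      ...   | no j≮au | _       = contradiction (lowNeighbour⇒high e j≮au) ¬hv
      ...   | yes _   | no j≮av = contradiction (lowNeighbour⇒high (Graph.sym G e) j≮av) ¬hu
      ...   | yes nlu | yes nlv with I t u ≟ᵇ true | I t v ≟ᵇ true
      ...     | no ¬Iu | _      = inj₁ (cover-missed (dec-true (nonLow? j u) nlu) (¬-not ¬Iu))
      ...     | yes _  | no ¬Iv = inj₂ (cover-missed (dec-true (nonLow? j v) nlv) (¬-not ¬Iv))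
      ...     | yes Iu | yes Iv = ⊥-elim (I-independent t e Iu Iv)

      coverCount-≤ : ∀ v {j} → j ℕ.< D →
                     sumBelow N (λ t → ⟦ cover j t v ⟧) ℕ.≤ l ℕ.* (⟦ nonLow j v ⟧ ℕ.+ ⟦ high j v ⟧)
      coverCount-≤ v {j} j<D with high? j v | nonLow? j v
      ... | yes h | _ = begin
        sumBelow N (λ t → ⟦ cover j t v ⟧)      ≡⟨ sumBelow-cong N (λ t _ → cong ⟦_⟧ (cover-high high≡true)) ⟩
        sumBelow N (λ _ → 1)                    ≡⟨ trans (sumBelow-const N 1) (ℕ.*-identityʳ N) ⟩
        N                                       ≤⟨ N≤l+l ⟩
        l ℕ.+ l                                 ≡⟨ trans (ℕ.*-comm l 2) (cong (l ℕ.+_) (ℕ.+-identityʳ l)) ⟨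
        l ℕ.* 2                                 ≡⟨ cong₂ (λ x y → l ℕ.* (⟦ x ⟧ ℕ.+ ⟦ y ⟧)) nonLow≡true high≡true ⟨
        l ℕ.* (⟦ nonLow j v ⟧ ℕ.+ ⟦ high j v ⟧)  ∎
        where
        open ℕ.≤-Reasoning
        high≡true   = dec-true (high? j v) h
        nonLow≡true = dec-true (nonLow? j v) (high⇒nonLow j<D h)
      ... | no ¬h | yes nl = begin
        sumBelow N (λ t → ⟦ cover j t v ⟧)      ≡⟨ sumBelow-cong N (λ t _ → cong ⟦_⟧ (cover-middle high≡false nonLow≡true)) ⟩
        sumBelow N (λ t → ⟦ not (I t v) ⟧)      ≤⟨ I-misses-≤ v ⟩
        l                                       ≡⟨ ℕ.*-identityʳ l ⟨
        l ℕ.* 1                                 ≡⟨ cong₂ (λ x y → l ℕ.* (⟦ x ⟧ ℕ.+ ⟦ y ⟧)) nonLow≡true high≡false ⟨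
        l ℕ.* (⟦ nonLow j v ⟧ ℕ.+ ⟦ high j v ⟧)  ∎
        where
        open ℕ.≤-Reasoning
        high≡false  = dec-false (high? j v) ¬h
        nonLow≡true = dec-true (nonLow? j v) nl
      ... | no ¬h | no ¬nl = begin
        sumBelow N (λ t → ⟦ cover j t v ⟧)      ≡⟨ sumBelow-cong N (λ t _ → cong ⟦_⟧ (cover-low high≡false nonLow≡false)) ⟩
        sumBelow N (λ _ → 0)                    ≡⟨ trans (sumBelow-const N 0) (ℕ.*-zeroʳ N) ⟩
        0                                       ≤⟨ z≤n ⟩
        l ℕ.* (⟦ nonLow j v ⟧ ℕ.+ ⟦ high j v ⟧)  ∎
        where
        open ℕ.≤-Reasoning
        high≡false   = dec-false (high? j v) ¬h
        nonLow≡false = dec-false (nonLow? j v) ¬nl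

      coverCount-total-≤ : ∀ v → sumBelow D (λ j → sumBelow N (λ t → ⟦ cover j t v ⟧)) ℕ.≤ (l ℕ.+ l) ℕ.* X v
      coverCount-total-≤ v = begin
        sumBelow D (λ j → sumBelow N (λ t → ⟦ cover j t v ⟧))           ≤⟨ sumBelow-mono D (λ j j<D → coverCount-≤ v j<D) ⟩
        sumBelow D (λ j → l ℕ.* (⟦ nonLow j v ⟧ ℕ.+ ⟦ high j v ⟧))       ≡⟨ sumBelow-*ˡ D l _ ⟩
        l ℕ.* sumBelow D (λ j → ⟦ nonLow j v ⟧ ℕ.+ ⟦ high j v ⟧)        ≡⟨ cong (l ℕ.*_) (sumBelow-+ D _ _) ⟩
        l ℕ.* (sumBelow D (λ j → ⟦ nonLow j v ⟧) ℕ.+ sumBelow D (λ j → ⟦ high j v ⟧))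
                                                                        ≤⟨ ℕ.*-monoʳ-≤ l (threshold-count D (a v)) ⟩
        l ℕ.* (X v ℕ.+ X v)                                             ≡⟨ ℕ.*-distribˡ-+ l (X v) (X v) ⟩
        l ℕ.* X v ℕ.+ l ℕ.* X v                                         ≡⟨ ℕ.*-distribʳ-+ (X v) l l ⟨
        (l ℕ.+ l) ℕ.* X v                                               ∎
        where open ℕ.≤-Reasoning

    rounding-bound : ∀ (w : Fin n → ℚ) {z m} → NonNeg w → IsLPOpt G w z → IsVCOpt G w m → toℚ N * m ≤ toℚ (l ℕ.+ l) * z
    rounding-bound w {z} {m} w≥0 ((x , (x≥0 , x-feasible) , wx≡z) , _) (_ , m-minimal)
      with D′ , X , X≡Dx ← commonDenominator x x≥0
      = *-cancelˡ-≤-pos (toℚ (suc D′)) {{positive (toℚ-pos D′)}} (begin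
        toℚ D * (toℚ N * m)
          ≡⟨ trans (sum-cong-≗ {D} (λ _ → sum-const N m)) (sum-const D (toℚ N * m)) ⟨
        sum {D} (λ _ → sum {N} (λ _ → m))
          ≤⟨ sum-mono-≤ {D} (λ j → sum-mono-≤ {N} (λ t → m-minimal _ (cover-isVertexCover (toℕ j) (toℕ t)))) ⟩
        sum {D} (λ j → sum {N} (λ t → coverWeight w (cover (toℕ j) (toℕ t))))
          ≡⟨ coverWeight-doubleCounting D N w cover ⟩
        sum (λ v → w v * toℚ (sumBelow D (λ j → sumBelow N (λ t → ⟦ cover j t v ⟧))))
          ≤⟨ sum-mono-≤ (λ v → *-monoˡ-≤-nonNeg (w v) {{nonNegative (w≥0 v)}} (toℚ-mono-≤ (coverCount-total-≤ v))) ⟩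
        sum (λ v → w v * toℚ ((l ℕ.+ l) ℕ.* X v))
          ≡⟨ scaledObjective w x D X X≡Dx (l ℕ.+ l) ⟩
        toℚ D * (toℚ (l ℕ.+ l) * objective w x)
          ≡⟨ cong (λ s → toℚ D * (toℚ (l ℕ.+ l) * s)) wx≡z ⟩
        toℚ D * (toℚ (l ℕ.+ l) * z)
          ∎)
      where
      D = suc D′
      open ThresholdCovers D X (λ {u} {v} e → scaledFeasible {x = x} {D} {X} X≡Dx (x-feasible u v e))
      open ≤-Reasoning

module UpperBound where

  open import Data.Nat as ℕ using (ℕ; zero; suc; NonZero)
  import Data.Nat.Properties as ℕ
  open import Data.Fin using (Fin; zero; suc)
  open import Data.Fin.Properties using (sequence)
  open import Data.Bool using (Bool; true; not)
  open import Data.Empty using (⊥)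
  open import Data.Rational using (ℚ; 1ℚ; _+_; _*_; _≤_; _⊓_)
  open import Data.Rational.Properties using (_≤?_; ⊓-sel; p⊓q≤p; p⊓q≤q; ≤-trans; +-monoʳ-≤)
  open import Data.Product using (∃-syntax; _,_)
  open import Data.Sum using (inj₁; inj₂)
  open import Effect.Monad using (RawMonad)
  open import Relation.Nullary using (Dec; ¬_)
  open import Relation.Nullary.Decidable using (decidable-stable; ¬¬-excluded-middle)
  open import Relation.Nullary.Negation using (¬¬-Monad)
  open import Relation.Binary.PropositionalEquality using (_≡_; refl; sym; trans; cong; subst)

  open import Defs hiding (sym)
  open Arithmetic
  open Rationals
  open Walks
  open Contraction
  open CycleGraph
  open ThresholdRounding

  module _ {n} (G : Graph n) (adjacent? : ∀ u v → Dec (Adj G u v))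
           (c : Fin n → Fin 3) (proper : ProperColoring G 3 c) (i : Fin 3)
           (K : ℕ) .{{_ : NonZero K}} (girth : IsOddGirth (ContractAdj G c i) (suc (2 ℕ.* K))) where

    open OddCycleGraph K
    open Layering G adjacent? c proper i K
           (λ ca≡i cb≡i → oddGirth-≤-walk G c i proper girth (trans (contractMap-colour G c i ca≡i) (sym (contractMap-colour G c i cb≡i))))

    I : ℕ → Fin n → Bool
    I t v = isOdd ((pos v ℕ.+ t) ℕ.% g)

    I-independent : ∀ t {u v} → Adj G u v → I t u ≡ true → I t v ≡ true → ⊥
    I-independent t {u} {v} e Iu Iv =
      oddResidues-independent (CyclicAdj-shift t (pos-homomorphism e))
        (isOdd⇒parity≡1ℙ {(pos u ℕ.+ t) ℕ.% g} Iu) (isOdd⇒parity≡1ℙ {(pos v ℕ.+ t) ℕ.% g} Iv)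

    I-misses-≤ : ∀ v → sumBelow g (λ t → ⟦ not (I t v) ⟧) ℕ.≤ suc K
    I-misses-≤ v = ℕ.≤-reflexive (count-evenResidues (pos v))

    colourBound : ∀ (w : Fin n → ℚ) {z m} → NonNeg w → IsLPOpt G w z → IsVCOpt G w m → m ≤ (1ℚ + oddRecip (suc K)) * z
    colourBound w {z} {m} w≥0 lp vc =
      ratioBound (2 ℕ.* K) (subst (λ N → toℚ g * m ≤ toℚ N * z) (sym 1+g≡2[1+K])
                                  (rounding-bound G g≤2[1+K] I I-independent I-misses-≤ w w≥0 lp vc))
      where
      g≤2[1+K] : g ℕ.≤ suc K ℕ.+ suc K
      g≤2[1+K] = ℕ.≤-trans (ℕ.n≤1+n g) (ℕ.≤-reflexive 1+g≡2[1+K])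

  adjacency-¬¬decidable : ∀ {n} (G : Graph n) → ¬ ¬ (∀ u v → Dec (Adj G u v))
  adjacency-¬¬decidable G = sequence ¬¬-applicative (λ u → sequence ¬¬-applicative (λ v → ¬¬-excluded-middle))
    where ¬¬-applicative = RawMonad.rawApplicative ¬¬-Monad

  gapBound-attained : ∀ ρ → ∃[ i ] gapBound ρ ≡ 1ℚ + oddRecip (ρ i)
  gapBound-attained ρ with ⊓-sel (o (suc zero)) (o (suc (suc zero))) | ⊓-sel (o zero) (o (suc zero) ⊓ o (suc (suc zero)))
    where o = λ i → oddRecip (ρ i)
  ... | _         | inj₁ min≡o₀ = zero , cong (1ℚ +_) min≡o₀
  ... | inj₁ o₁₂≡o₁ | inj₂ min≡o₁₂ = suc zero , cong (1ℚ +_) (trans min≡o₁₂ o₁₂≡o₁)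
  ... | inj₂ o₁₂≡o₂ | inj₂ min≡o₁₂ = suc (suc zero) , cong (1ℚ +_) (trans min≡o₁₂ o₁₂≡o₂)

  gapBound-≤ : ∀ ρ i → gapBound ρ ≤ 1ℚ + oddRecip (ρ i)
  gapBound-≤ ρ i = +-monoʳ-≤ 1ℚ (min≤ i)
    where
    o = λ i → oddRecip (ρ i)
    min≤ : ∀ i → o zero ⊓ (o (suc zero) ⊓ o (suc (suc zero))) ≤ o i
    min≤ zero             = p⊓q≤p (o zero) _
    min≤ (suc zero)       = ≤-trans (p⊓q≤q (o zero) _) (p⊓q≤p (o (suc zero)) _)
    min≤ (suc (suc zero)) = ≤-trans (p⊓q≤q (o zero) _) (p⊓q≤q (o (suc zero)) _)

  integralityGap-≤ : ∀ {n} (G : Graph n) (c : Fin n → Fin 3) (ρ : Fin 3 → ℕ) → ProperColoring G 3 c →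
                     (∀ i → IsOddGirth (ContractAdj G c i) (2 ℕ.* ρ i ℕ.∸ 1)) → IGAtMost G (gapBound ρ)
  -- Adjacency need not be decidable, but the goal m ≤ B * z is decidable and the decidability of
  -- adjacency on the finitely many pairs of vertices is irrefutable, so the goal may be proved assuming it.
  integralityGap-≤ G c ρ proper girth w z m w≥0 lp _ vc with i , gap≡ ← gapBound-attained ρ =
    decidable-stable (m ≤? gapBound ρ * z)
      (λ m≰Bz → adjacency-¬¬decidable G (λ adjacent? → m≰Bz (subst (λ B → m ≤ B * z) (sym gap≡) (bound adjacent? (ρ i) (girth i)))))
    where
    bound : (∀ u v → Dec (Adj G u v)) → ∀ r → IsOddGirth (ContractAdj G c i) (2 ℕ.* r ℕ.∸ 1) → m ≤ (1ℚ + oddRecip r) * z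
    bound adjacent? r girthᵢ with K , refl , girth′ ← oddGirth-shape {ρ = r} girthᵢ =
      colourBound G adjacent? c proper i (suc K) girth′ w w≥0 lp vc

module LowerBound where

  open import Data.Nat as ℕ using (ℕ; zero; suc; z≤n; s≤s)
  import Data.Nat.Properties as ℕ
  open import Data.Fin using (Fin; zero; suc; toℕ; inject₁; fromℕ)
  open import Data.Fin.Properties using (any?; toℕ-injective; toℕ<n) renaming (_≟_ to _≟ᶠ_)
  open import Data.Maybe using (Maybe)
  open import Data.Parity.Base as ℙ using (1ℙ; _⁻¹)
  open import Data.Parity.Properties using (+-homo-+; *-homo-*) renaming (_≟_ to _≟ᵖ_)
  open import Data.Bool using (Bool; true; not; if_then_else_)
  open import Data.Empty using (⊥-elim)
  open import Data.Integer as ℤ using ()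
  open import Data.Rational using (ℚ; 0ℚ; 1ℚ; _+_; _*_; _-_; _≤_; _<_; _/_; positive; nonNegative)
  open import Data.Rational.Properties
    using ( ≤-refl; <⇒≤; nonNegative⁻¹; positive⁻¹; pos*pos⇒pos; +-comm; +-identityʳ; *-identityʳ
          ; +-mono-≤; +-monoʳ-<; *-monoʳ-≤-nonNeg; module ≤-Reasoning)
  open import Data.Rational.Solver using (module +-*-Solver)
  open import Data.Product using (∃-syntax; _×_; _,_; proj₁; proj₂)
  open import Data.Sum using (_⊎_; inj₁; inj₂)
  open import Function.Bundles using (_⇔_)
  open import Relation.Nullary using (Dec; does; yes; no; ¬_; contradiction; _×-dec_)
  open import Relation.Nullary.Decidable using (dec-true; dec-false)
  open import Relation.Binary.Definitions using (tri<; tri≈; tri>)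
  open import Relation.Binary.PropositionalEquality using (_≡_; _≢_; refl; sym; trans; cong; cong₂; subst; module ≡-Reasoning)

  open import Defs hiding (sym)
  open Arithmetic
  open Rationals
  open Walks
  open Contraction
  open CycleGraph using (module OddCycleGraph)
  import Algebra.Properties.Semiring.Sum ℕ.+-*-semiring as ℕΣ

  ½ : ℚ
  ½ = ℤ.+ 1 / 2

  double-½ : ∀ s → (s + s) * ½ ≡ s
  double-½ = solve 1 (λ s → (s :+ s) :* con ½ := s) refl
    where open +-*-Solver

  cycleSum : ∀ {M} (y : Fin (suc M) → ℚ) → (∀ j → 1ℚ ≤ y (inject₁ j) + y (suc j)) → 1ℚ ≤ y (fromℕ M) + y zero →
             toℚ (suc M) ≤ sum y + sum y
  cycleSum {M} y steps close = begin
    toℚ (suc M)                                    ≡⟨ cong (1ℚ +_) (trans (sym (*-identityʳ (toℚ M))) (sym (sum-const M 1ℚ))) ⟩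
    1ℚ + sum {M} (λ _ → 1ℚ)                        ≤⟨ +-mono-≤ close (sum-mono-≤ steps) ⟩
    (l + y zero) + sum (λ j → y (inject₁ j) + y (suc j)) ≡⟨ cong ((l + y zero) +_) (∑-distrib-+ (λ j → y (inject₁ j)) (λ j → y (suc j))) ⟩
    (l + y zero) + (A + B)                         ≡⟨ solve 4 (λ l y₀ a b → (l :+ y₀) :+ (a :+ b) := (a :+ l) :+ (y₀ :+ b)) refl l (y zero) A B ⟩
    (A + l) + (y zero + B)                         ≡⟨ cong (_+ (y zero + B)) (sum-init-last y) ⟨
    sum y + sum y                                  ∎
    where
    open ≤-Reasoning
    open +-*-Solver
    l = y (fromℕ M)
    A = sum (λ j → y (inject₁ j))
    B = sum (λ j → y (suc j))

  module _ {n} (G : Graph n) (c : Fin n → Fin 3) (proper : ProperColoring G 3 c) (i : Fin 3)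
           {v₀ : Fin n} (singleton : ∀ u → (c u ≡ i) ⇔ (u ≡ v₀))
           (K : ℕ) (girth : IsOddGirth (ContractAdj G c i) (suc (2 ℕ.* K))) where

    open Singleton G c i singleton
    open OddCycleGraph K using (g; count-even-below; 1+g≡2[1+K])

    private
      π : Fin n → Maybe (Fin n)
      π = contractMap c i
      module C = Cycle (proj₁ (proj₂ girth))

    M : ℕ
    M = C.m

    M≡2K : M ≡ 2 ℕ.* K
    M≡2K = ℕ.suc-injective (sym C.len)

    f : Fin (suc M) → Fin n
    f a = expand (C.w a)

    f-step : ∀ j → Adj G (f (inject₁ j)) (f (suc j))
    f-step j = expand-adjacent (C.step j)

    f-close : Adj G (f (fromℕ M)) (f zero)
    f-close = expand-adjacent C.close

    contractMap-f : ∀ a → π (f a) ≡ C.w a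
    contractMap-f zero    with _ , v , _ , _ , πv≡w ← C.close  = contractMap-expand v πv≡w
    contractMap-f (suc j) with _ , v , _ , _ , πv≡w ← C.step j = contractMap-expand v πv≡w

    f-injective : ∀ {a b} → f a ≡ f b → a ≡ b
    f-injective {a} {b} fa≡fb = C.distinct (trans (sym (contractMap-f a)) (trans (cong π fa≡fb) (contractMap-f b)))

    longOddClosedWalks : ∀ {x L} → Walk (Adj G) x x L → Odd L → g ℕ.≤ L
    longOddClosedWalks = oddGirth-≤-walk G c i proper girth refl

    noChord< : ∀ {a b} → toℕ a ℕ.< toℕ b → ℕ.parity (toℕ a) ≡ 1ℙ → ℕ.parity (toℕ b) ≡ 1ℙ → ¬ Adj G (f a) (f b)
    noChord< {a} {b} a<b odd-a odd-b e =
      ℕ.<⇒≱ short (longOddClosedWalks (Graph.sym G e ∷ along f f-step a b (ℕ.<⇒≤ a<b)) (parity≡1ℙ⇒Odd (suc ℓ) odd-ℓ+1))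
      where
      ℓ = toℕ b ℕ.∸ toℕ a
      a+ℓ≡b : toℕ a ℕ.+ ℓ ≡ toℕ b
      a+ℓ≡b = ℕ.m+[n∸m]≡n (ℕ.<⇒≤ a<b)
      odd-ℓ+1 : ℕ.parity (suc ℓ) ≡ 1ℙ
      odd-ℓ+1 = trans (+-homo-+ 1 ℓ) (begin
        ℕ.parity ℓ ⁻¹                    ≡⟨ cong (ℙ._+ ℕ.parity ℓ) odd-a ⟨
        ℕ.parity (toℕ a) ℙ.+ ℕ.parity ℓ  ≡⟨ +-homo-+ (toℕ a) ℓ ⟨
        ℕ.parity (toℕ a ℕ.+ ℓ)           ≡⟨ cong ℕ.parity a+ℓ≡b ⟩
        ℕ.parity (toℕ b)                 ≡⟨ odd-b ⟩
        1ℙ                               ∎)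
        where open ≡-Reasoning
      1≤a : 1 ℕ.≤ toℕ a
      1≤a = ℕ.n≢0⇒n>0 (λ a≡0 → contradiction (trans (sym odd-a) (cong ℕ.parity a≡0)) λ ())
      b<M : toℕ b ℕ.< M
      b<M = ℕ.≤∧≢⇒< (ℕ.s≤s⁻¹ (toℕ<n b)) b≢M
        where
        b≢M : toℕ b ≢ M
        b≢M b≡M = contradiction (trans (sym odd-b) (trans (cong ℕ.parity (trans b≡M M≡2K)) (*-homo-* 2 K))) λ ()
      short : suc ℓ ℕ.< g
      short = begin-strict
        suc ℓ          ≤⟨ ℕ.+-monoˡ-≤ ℓ 1≤a ⟩
        toℕ a ℕ.+ ℓ    ≡⟨ a+ℓ≡b ⟩
        toℕ b          <⟨ b<M ⟩
        M              ≡⟨ M≡2K ⟩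
        2 ℕ.* K        <⟨ ℕ.n<1+n (2 ℕ.* K) ⟩
        g              ∎
        where open ℕ.≤-Reasoning

    oddPositions-independent : ∀ a b → ℕ.parity (toℕ a) ≡ 1ℙ → ℕ.parity (toℕ b) ≡ 1ℙ → ¬ Adj G (f a) (f b)
    oddPositions-independent a b odd-a odd-b e with ℕ.<-cmp (toℕ a) (toℕ b)
    ... | tri< a<b _ _ = noChord< a<b odd-a odd-b e
    ... | tri≈ _ a≡b _ = irrefl G (subst (λ x → Adj G (f a) (f x)) (sym (toℕ-injective a≡b)) e)
    ... | tri> _ _ b<a = noChord< b<a odd-b odd-a (Graph.sym G e)

    cycleWeight : Fin n → ℚ
    cycleWeight u = sum (λ a → toℚ ⟦ does (f a ≟ᶠ u) ⟧)

    cycleWeight-nonNeg : NonNeg cycleWeight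
    cycleWeight-nonNeg u = sum-nonNeg (λ a → toℚ-nonNeg ⟦ does (f a ≟ᶠ u) ⟧)

    objective-cycleWeight : ∀ y → objective cycleWeight y ≡ sum (λ a → y (f a))
    objective-cycleWeight y = begin
      objective cycleWeight y                          ≡⟨ sumFin≡sum (λ u → cycleWeight u * y u) ⟩
      sum (λ u → cycleWeight u * y u)                  ≡⟨ sum-cong-≗ {n} (λ u → *-distribʳ-sum (y u) (λ a → δ a u)) ⟩
      sum {n} (λ u → sum {suc M} (λ a → δ a u * y u))  ≡⟨ ∑-comm (λ u a → δ a u * y u) ⟩
      sum {suc M} (λ a → sum {n} (λ u → δ a u * y u))  ≡⟨ sum-cong-≗ {suc M} (λ a → sum-indicator (f a) y) ⟩
      sum (λ a → y (f a))                              ∎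
      where
      open ≡-Reasoning
      δ : Fin (suc M) → Fin n → ℚ
      δ a u = toℚ ⟦ does (f a ≟ᶠ u) ⟧

    coverWeight-cycleWeight : ∀ C → coverWeight cycleWeight C ≡ sum (λ a → toℚ ⟦ C (f a) ⟧)
    coverWeight-cycleWeight C = begin
      coverWeight cycleWeight C                        ≡⟨ sumFin≡sum (λ u → if C u then cycleWeight u else 0ℚ) ⟩
      sum (λ u → if C u then cycleWeight u else 0ℚ)    ≡⟨ sum-cong-≗ {n} (λ u → if-then-0≡*⟦ C u ⟧ (cycleWeight u)) ⟩
      sum (λ u → cycleWeight u * toℚ ⟦ C u ⟧)          ≡⟨ sumFin≡sum (λ u → cycleWeight u * toℚ ⟦ C u ⟧) ⟨
      objective cycleWeight (λ u → toℚ ⟦ C u ⟧)        ≡⟨ objective-cycleWeight (λ u → toℚ ⟦ C u ⟧) ⟩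
      sum (λ a → toℚ ⟦ C (f a) ⟧)                      ∎
      where open ≡-Reasoning

    z₀ : ℚ
    z₀ = toℚ g * ½

    z₀-pos : 0ℚ < z₀
    z₀-pos = positive⁻¹ z₀ {{pos*pos⇒pos (toℚ g) {{positive (toℚ-pos (2 ℕ.* K))}} ½}}

    lpOptimum : IsLPOpt G cycleWeight z₀
    lpOptimum = ((λ _ → ½) , ((λ _ → nonNegative⁻¹ ½) , (λ _ _ _ → ≤-refl)) , value) , optimal
      where
      value : objective cycleWeight (λ _ → ½) ≡ z₀
      value = trans (objective-cycleWeight (λ _ → ½)) (trans (sum-const (suc M) ½) (cong (λ k → toℚ (suc k) * ½) M≡2K))
      optimal : ∀ x → FracCover G x → z₀ ≤ objective cycleWeight x
      optimal x (_ , feasible) = begin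
        toℚ g * ½                               ≡⟨ cong (λ k → toℚ (suc k) * ½) M≡2K ⟨
        toℚ (suc M) * ½                         ≤⟨ *-monoʳ-≤-nonNeg ½ (cycleSum (λ a → x (f a)) (λ j → feasible _ _ (f-step j))
                                                                                                  (feasible _ _ f-close)) ⟩
        (sum (λ a → x (f a)) + sum (λ a → x (f a))) * ½ ≡⟨ double-½ (sum (λ a → x (f a))) ⟩
        sum (λ a → x (f a))                     ≡⟨ objective-cycleWeight x ⟨
        objective cycleWeight x                 ∎
        where open ≤-Reasoning

    oddCycleVertex? : ∀ u → Dec (∃[ a ] (ℕ.parity (toℕ a) ≡ 1ℙ × f a ≡ u))
    oddCycleVertex? u = any? (λ a → (ℕ.parity (toℕ a) ≟ᵖ 1ℙ) ×-dec (f a ≟ᶠ u))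

    C₀ : Fin n → Bool
    C₀ u = not (does (oddCycleVertex? u))

    C₀-cover : VertexCover G C₀
    C₀-cover u v e with oddCycleVertex? u | oddCycleVertex? v
    ... | no ¬hu                | _                     = inj₁ (cong not (dec-false (oddCycleVertex? u) ¬hu))
    ... | yes _                 | no ¬hv                = inj₂ (cong not (dec-false (oddCycleVertex? v) ¬hv))
    ... | yes (a , odd-a , refl) | yes (b , odd-b , refl) = ⊥-elim (oddPositions-independent a b odd-a odd-b e)

    C₀-on-cycle : ∀ b → C₀ (f b) ≡ not (isOdd (toℕ b))
    C₀-on-cycle b with ℕ.parity (toℕ b) ≟ᵖ 1ℙ
    ... | yes odd-b = cong not (dec-true (oddCycleVertex? (f b)) (b , odd-b , refl))
    ... | no ¬odd-b = cong not (dec-false (oddCycleVertex? (f b)) hit⇒odd)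
      where
      hit⇒odd : ¬ (∃[ a ] (ℕ.parity (toℕ a) ≡ 1ℙ × f a ≡ f b))
      hit⇒odd (a , odd-a , fa≡fb) = ¬odd-b (subst (λ x → ℕ.parity (toℕ x) ≡ 1ℙ) (f-injective fa≡fb) odd-a)

    m₀ : ℚ
    m₀ = toℚ (suc K)

    C₀-weight : coverWeight cycleWeight C₀ ≡ m₀
    C₀-weight = begin
      coverWeight cycleWeight C₀                          ≡⟨ coverWeight-cycleWeight C₀ ⟩
      sum {suc M} (λ a → toℚ ⟦ C₀ (f a) ⟧)                ≡⟨ sum-cong-≗ {suc M} (λ a → cong (λ b → toℚ ⟦ b ⟧) (C₀-on-cycle a)) ⟩
      sum {suc M} (λ a → toℚ ⟦ not (isOdd (toℕ a)) ⟧)     ≡⟨ toℚ-sumBelow (suc M) (λ t → ⟦ not (isOdd t) ⟧) ⟩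
      toℚ (sumBelow (suc M) (λ t → ⟦ not (isOdd t) ⟧))    ≡⟨ cong (λ k → toℚ (sumBelow (suc k) (λ t → ⟦ not (isOdd t) ⟧))) M≡2K ⟩
      toℚ (sumBelow g (λ t → ⟦ not (isOdd t) ⟧))          ≡⟨ cong toℚ count-even-below ⟩
      m₀                                                  ∎
      where open ≡-Reasoning

    edge-covered : ∀ C → VertexCover G C → ∀ {u v} → Adj G u v → 1ℚ ≤ toℚ ⟦ C u ⟧ + toℚ ⟦ C v ⟧
    edge-covered C cover {u} {v} e = subst (1ℚ ≤_) (toℚ-+ ⟦ C u ⟧ ⟦ C v ⟧) (toℚ-mono-≤ (atLeastOne (cover u v e)))
      where
      atLeastOne : C u ≡ true ⊎ C v ≡ true → 1 ℕ.≤ ⟦ C u ⟧ ℕ.+ ⟦ C v ⟧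
      atLeastOne (inj₁ Cu) = subst (λ b → 1 ℕ.≤ ⟦ b ⟧ ℕ.+ ⟦ C v ⟧) (sym Cu) (s≤s z≤n)
      atLeastOne (inj₂ Cv) = subst (λ b → 1 ℕ.≤ ⟦ C u ⟧ ℕ.+ ⟦ b ⟧) (sym Cv) (ℕ.m≤n+m 1 ⟦ C u ⟧)

    cover-meets-cycle : ∀ C → VertexCover G C → suc K ℕ.≤ ℕΣ.sum (λ a → ⟦ C (f a) ⟧)
    cover-meets-cycle C cover = halve (toℚ-cancel-≤ twice)
      where
      hits : Fin (suc M) → ℕ
      hits a = ⟦ C (f a) ⟧
      s : ℕ
      s = ℕΣ.sum hits
      twice : toℚ (suc M) ≤ toℚ (s ℕ.+ s)
      twice = subst (toℚ (suc M) ≤_) (trans (cong₂ _+_ (toℚ-sumℕ hits) (toℚ-sumℕ hits)) (sym (toℚ-+ s s)))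
                (cycleSum (λ a → toℚ ⟦ C (f a) ⟧) (λ j → edge-covered C cover (f-step j)) (edge-covered C cover f-close))
      halve : suc M ℕ.≤ s ℕ.+ s → suc K ℕ.≤ s
      halve M<s+s with suc K ℕ.≤? s
      ... | yes K<s = K<s
      ... | no  K≮s = contradiction (ℕ.≤-trans M<s+s (ℕ.≤-trans (ℕ.+-mono-≤ s≤K s≤K) K+K≤M)) (ℕ.n≮n M)
        where
        s≤K : s ℕ.≤ K
        s≤K = ℕ.s≤s⁻¹ (ℕ.≰⇒> K≮s)
        K+K≤M : K ℕ.+ K ℕ.≤ M
        K+K≤M = ℕ.≤-reflexive (trans (cong (K ℕ.+_) (sym (ℕ.+-identityʳ K))) (sym M≡2K))

    m₀-minimal : ∀ C → VertexCover G C → m₀ ≤ coverWeight cycleWeight C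
    m₀-minimal C cover =
      subst (m₀ ≤_) (trans (sym (toℚ-sumℕ (λ a → ⟦ C (f a) ⟧))) (sym (coverWeight-cycleWeight C))) (toℚ-mono-≤ (cover-meets-cycle C cover))

    vcOptimum : IsVCOpt G cycleWeight m₀
    vcOptimum = (C₀ , C₀-cover , C₀-weight) , m₀-minimal

    bound-attained : (1ℚ + oddRecip (suc K)) * z₀ ≡ m₀
    bound-attained = begin
      (1ℚ + r) * (toℚ g * ½)         ≡⟨ solve 3 (λ r t h → (con 1ℚ :+ r) :* (t :* h) := (t :+ t :* r) :* h) refl r (toℚ g) ½ ⟩
      (toℚ g + toℚ g * r) * ½         ≡⟨ cong (λ q → (toℚ g + q) * ½) (toℚ-*-1/suc (2 ℕ.* K)) ⟩
      (toℚ g + 1ℚ) * ½                ≡⟨ cong (_* ½) (+-comm (toℚ g) 1ℚ) ⟩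
      toℚ (suc g) * ½                 ≡⟨ cong (λ k → toℚ k * ½) 1+g≡2[1+K] ⟩
      toℚ (suc K ℕ.+ suc K) * ½       ≡⟨ cong (_* ½) (toℚ-+ (suc K) (suc K)) ⟩
      (m₀ + m₀) * ½                   ≡⟨ double-½ m₀ ⟩
      m₀                              ∎
      where
      open ≡-Reasoning
      open +-*-Solver
      r = oddRecip (suc K)

    gapWitness : ∀ B → B ≤ 1ℚ + oddRecip (suc K) → ∀ ε → 0ℚ < ε →
            ∃[ w ] ∃[ z ] ∃[ m ] (NonNeg w × IsLPOpt G w z × 0ℚ < z × IsVCOpt G w m × (B - ε) * z < m)
    gapWitness B B≤bound ε ε>0 = cycleWeight , z₀ , m₀ , cycleWeight-nonNeg , lpOptimum , z₀-pos , vcOptimum , (begin-strict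
      (B - ε) * z₀                     ≡⟨ +-identityʳ _ ⟨
      (B - ε) * z₀ + 0ℚ                <⟨ +-monoʳ-< ((B - ε) * z₀) εz₀>0 ⟩
      (B - ε) * z₀ + ε * z₀            ≡⟨ solve 3 (λ b e z → (b :- e) :* z :+ e :* z := b :* z) refl B ε z₀ ⟩
      B * z₀                           ≤⟨ *-monoʳ-≤-nonNeg z₀ {{nonNegative (<⇒≤ z₀-pos)}} B≤bound ⟩
      (1ℚ + oddRecip (suc K)) * z₀     ≡⟨ bound-attained ⟩
      m₀                               ∎)
      where
      open ≤-Reasoning
      open +-*-Solver
      εz₀>0 : 0ℚ < ε * z₀
      εz₀>0 = positive⁻¹ (ε * z₀) {{pos*pos⇒pos ε {{positive ε>0}} z₀ {{positive z₀-pos}}}}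

  integralityGap-attained : ∀ {n} (G : Graph n) (c : Fin n → Fin 3) → ProperColoring G 3 c →
    ∀ i {v₀} → (∀ u → (c u ≡ i) ⇔ (u ≡ v₀)) → ∀ r → IsOddGirth (ContractAdj G c i) (2 ℕ.* r ℕ.∸ 1) →
    ∀ B → B ≤ 1ℚ + oddRecip r → ∀ ε → 0ℚ < ε →
    ∃[ w ] ∃[ z ] ∃[ m ] (NonNeg w × IsLPOpt G w z × 0ℚ < z × IsVCOpt G w m × (B - ε) * z < m)
  integralityGap-attained G c proper i singleton r girth with K , refl , girth′ ← oddGirth-shape {ρ = r} girth =
    gapWitness G c proper i singleton (suc K) girth′


open import Defs
open import Data.Nat using (ℕ; _*_; _∸_)
open import Data.Fin using (Fin)
open import Data.Product using (_×_; ∃-syntax; _,_)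
open import Relation.Binary.PropositionalEquality using (_≡_)
open import Function.Bundles using (_⇔_)

open UpperBound using (integralityGap-≤; gapBound-≤)
open LowerBound using (integralityGap-attained)

mainTheorem18 : ∀ {n : ℕ} (G : Graph n) (c : Fin n → Fin 3) (ρ : Fin 3 → ℕ) →
    ChromaticNumber3 G →
    ProperColoring G 3 c →
    (∀ i → IsOddGirth (ContractAdj G c i) (2 * ρ i ∸ 1)) →
    IGAtMost G (gapBound ρ) ×
    ((∃[ i ] ∃[ v ] (∀ u → (c u ≡ i) ⇔ (u ≡ v))) → IsIntegralityGap G (gapBound ρ))
mainTheorem18 G c ρ _ proper girth = upper , λ (i , _ , singleton) →
  upper , integralityGap-attained G c proper i singleton (ρ i) (girth i) (gapBound ρ) (gapBound-≤ ρ i)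
  where
  upper : IGAtMost G (gapBound ρ)
  upper = integralityGap-≤ G c ρ proper girth
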